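{- Let $x,z\ge 3$ be odd integers, let $y\ge 1$ be an integer, and let $W$ be a $w$-wall, where $w=\mathsf{odd}\big(2x+\max\{z,\tfrac{y}{4}-1\}\big)$. Then: \begin{itemize} \item there is a collection $\mathcal{P}$ of $y$ paths in $W$ such that, if $\mathcal{C}$ is the sequence of the first $x$ layers of $W$, then $(\mathcal{C},\mathcal{P})$ is an $(x,y)$-railed annulus of $W$ whose first cycle is the perimeter of $W$; and \item the open disk defined by the $x$-th cycle of $\mathcal{C}$ contains the vertices of the compass of the central $z$-subwall of $W$. \end{itemize}
   Context: For an integer $p\ge 0$, $\mathsf{odd}(p)$ is the smallest odd integer not smaller than $p$. For an odd $r\ge 3$, the elementary $r$-wall is obtained from the $(2r\times r)$-grid on vertex set $[2r]\times[r]$ (with $(i,j)\sim(i',j')$ iff $|i-i'|+|j-j'|=1$) by deleting the edges $\{(a,b),(a,b+1)\}$ with $a+b$ odd and then deleting all vertices of degree one; it has an essentially unique plane embedding in which all finite faces (bricks) are bounded by six edges, and its perimeter is the cycle bounding the infinite face. An $r$-wall is any subdivision of the elementary $r$-wall, embedded in the plane accordingly (perimeter bounding the infinite face); $r$ is its height. Its vertical and horizontal paths are the subdivisions of the natural vertical and horizontal paths of the elementary wall; a subwall of $W$ is a subgraph that is an $r'$-wall, $r'\le r$, whose vertical (resp. horizontal) paths are subpaths of vertical (resp. horizontal) paths of $W$. Layers: the first layer of $W$ is its perimeter; for $i=2,\dots,(r-1)/2$ the $i$-th layer is the $(i-1)$-th layer of the subwall obtained from $W$ by removing its perimeter and then repeatedly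 removing vertices of degree one. The central vertices of $W$ are its two degree-$3$ vertices lying on no layer, and for odd $3\le q\le r$ the central $q$-subwall of $W$ is the subwall of height $q$ having the same central vertices. The compass of the central $q$-subwall of $W$ consists of the part of $W$ drawn in the closed disk bounded by the perimeter of that subwall. If $G$ is embedded in a closed disk $\Delta$, a $\Delta$-nested sequence of cycles is a sequence $[C_1,\dots,C_x]$ of pairwise vertex-disjoint cycles of $G$, where $C_i$ bounds an open disk $D_i$ and $\Delta\supseteq D_1\supseteq\dots\supseteq D_x$; its annulus is $\overline{D_1}\setminus D_x$. An $(x,y)$-railed annulus of $G$ is a pair $(\mathcal{C},\mathcal{P})$ where $\mathcal{C}=[C_1,\dots,C_x]$ is a $\Delta$-nested sequence of cycles and $\mathcal{P}=[P_1,\dots,P_y]$ is a sequence of pairwise vertex-disjoint paths (rails) each contained in the annulus of $\mathcal{C}$, such that for every $i\in[x]$, $j\in[y]$, $C_i\cap P_j$ is a non-empty path. Here $W$ is viewed as embedded in the closed disk bounded by its perimeter. -}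

module Defs where

open import Data.Nat using (ℕ; zero; suc; _+_; _*_; _∸_; _≤_; _<_; _⊔_; _/_; _%_; _≡ᵇ_)
open import Data.Bool using (if_then_else_)
open import Data.List using (List; []; _∷_; _++_; map; upTo; length)
open import Data.List.Membership.Propositional using (_∈_)
open import Data.List.Relation.Unary.Unique.Propositional using (Unique)
open import Data.List.Relation.Unary.All using (All)
open import Data.Fin using (Fin)
open import Data.Product using (Σ; _×_; _,_)
open import Data.Sum using (_⊎_)
open import Data.Empty using (⊥)
open import Relation.Nullary using (¬_)
open import Relation.Binary.PropositionalEquality using (_≡_; _≢_)

odd : ℕ → ℕ
odd p = p + (1 ∸ (p % 2))

-- Since odd(q) for a real q
-- is the smallest odd integer ≥ q, we have odd(q) = odd(⌈q⌉), and
-- ⌈2x + max{z, y/4 - 1}⌉ = 2x + max{z, ⌈y/4⌉ - 1}, with ⌈y/4⌉ = (y+3)/4.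
wallHeight : ℕ → ℕ → ℕ → ℕ
wallHeight x y z = odd (2 * x + (z ⊔ (((y + 3) / 4) ∸ 1)))

-- The elementary r-wall, 0-indexed: vertices (i , j) with i < 2r, j < r
-- (i.e. (i+1 , j+1) ∈ [2r]×[r]), minus the two degree-one vertices
-- (2r-1 , 0) and (0 , r-1) (1-indexed: (2r,1) and (1,r)).

ElemVertex : ℕ → ℕ → ℕ → Set
ElemVertex r i j =
  i < 2 * r × j < r × ¬ (i ≡ 2 * r ∸ 1 × j ≡ 0) × ¬ (i ≡ 0 × j ≡ r ∸ 1)

data EEdge : Set where
  hor : ℕ → ℕ → EEdge
  ver : ℕ → ℕ → EEdge

-- vertical edges survive iff (i+1)+(j+1) is even, i.e. i + j even
ValidEdge : ℕ → EEdge → Set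
ValidEdge r (hor i j) = ElemVertex r i j × ElemVertex r (suc i) j
ValidEdge r (ver i j) = ElemVertex r i j × ElemVertex r i (suc j) × (i + j) % 2 ≡ 0

-- A w-wall: the subdivision of the elementary w-wall in which the edge e
-- is replaced by a path with  s e  internal vertices  mid e 0 … mid e (s e - 1).

data V : Set where
  node : ℕ → ℕ → V
  mid  : EEdge → ℕ → V

src tgt : EEdge → V
src (hor i j) = node i j
src (ver i j) = node i j
tgt (hor i j) = node (suc i) j
tgt (ver i j) = node i (suc j)

chain : (EEdge → ℕ) → EEdge → List V
chain s e = src e ∷ (map (mid e) (upTo (s e)) ++ (tgt e ∷ []))

data Step {A : Set} : List A → A → A → Set where
  here  : ∀ {a b L} → Step (a ∷ b ∷ L) a b
  there : ∀ {c L u v} → Step L u v → Step (c ∷ L) u v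

Consec : {A : Set} → List A → A → A → Set
Consec L u v = Step L u v ⊎ Step L v u

CConsec : {A : Set} → List A → A → A → Set
CConsec []      u v = ⊥
CConsec (a ∷ L) u v = Consec (a ∷ (L ++ (a ∷ []))) u v

WVertex : ℕ → (EEdge → ℕ) → V → Set
WVertex r s (node i j) = ElemVertex r i j
WVertex r s (mid e k)  = ValidEdge r e × k < s e

WAdj : ℕ → (EEdge → ℕ) → V → V → Set
WAdj r s u v = Σ EEdge λ e → ValidEdge r e × Consec (chain s e) u v

record Subgraph : Set₁ where
  field
    vtx : V → Set
    edg : V → V → Set
open Subgraph public

Iff : Set → Set → Set
Iff A B = (A → B) × (B → A)

spanned : ℕ → (EEdge → ℕ) → (EEdge → Set) → Subgraph
vtx (spanned r s S) v   = Σ EEdge λ e → ValidEdge r e × S e × v ∈ chain s e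
edg (spanned r s S) u v = Σ EEdge λ e → ValidEdge r e × S e × Consec (chain s e) u v

pathSubgraph : List V → Subgraph
vtx (pathSubgraph L) v   = v ∈ L
edg (pathSubgraph L) u v = Consec L u v

_∩G_ : Subgraph → Subgraph → Subgraph
vtx (H ∩G K) v   = vtx H v × vtx K v
edg (H ∩G K) u v = edg H u v × edg K u v

IsPathGraph : Subgraph → Set
IsPathGraph H = Σ (List V) λ L → L ≢ [] × Unique L ×
  (∀ v → Iff (vtx H v) (v ∈ L)) × (∀ u v → Iff (edg H u v) (Consec L u v))

IsCycleGraph : Subgraph → Set
IsCycleGraph H = Σ (List V) λ L → 3 ≤ length L × Unique L ×
  (∀ v → Iff (vtx H v) (v ∈ L)) × (∀ u v → Iff (edg H u v) (CConsec L u v))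

IsPathIn : ℕ → (EEdge → ℕ) → List V → Set
IsPathIn r s L = L ≢ [] × Unique L × All (WVertex r s) L ×
  (∀ u v → Step L u v → WAdj r s u v)

-- For t < (r-1)/2 let a = t, b = r-1-t.  The subwall S_t consists of
-- horizontal paths (rows) a..b and vertical paths a..b of the wall (the
-- m-th vertical path uses columns 2m and 2m+1), restricted to each other.
-- S_t is the central (r-2t)-subwall, and its perimeter is the (t+1)-th
-- layer of the wall.

hiB : ℕ → ℕ → ℕ
hiB r t = r ∸ 1 ∸ t

-- leftmost / rightmost column of row j inside S_t
lftC : ℕ → ℕ → ℕ → ℕ
lftC r t j =
  if j ≡ᵇ t then 2 * t + (t % 2)
  else if j ≡ᵇ hiB r t then 2 * t + (suc t % 2)
  else 2 * t

rgtC : ℕ → ℕ → ℕ → ℕ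
rgtC r t j =
  if j ≡ᵇ t then 2 * hiB r t + (t % 2)
  else if j ≡ᵇ hiB r t then 2 * hiB r t + (suc t % 2)
  else 2 * hiB r t + 1

CompassE : ℕ → ℕ → EEdge → Set
CompassE r t (hor i j) = t ≤ j × j ≤ hiB r t × lftC r t j ≤ i × suc i ≤ rgtC r t j
CompassE r t (ver i j) = t ≤ j × suc j ≤ hiB r t × 2 * t ≤ i × i ≤ 2 * hiB r t + 1

LayerE : ℕ → ℕ → EEdge → Set
LayerE r t (hor i j) =
  ((j ≡ t ⊎ j ≡ hiB r t) × lftC r t j ≤ i × suc i ≤ rgtC r t j)
  ⊎ (t < j × j < hiB r t × (i ≡ 2 * t ⊎ i ≡ 2 * hiB r t))
LayerE r t (ver i j) = t ≤ j × suc j ≤ hiB r t ×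
  (i ≡ 2 * t ⊎ i ≡ 2 * t + 1 ⊎ i ≡ 2 * hiB r t ⊎ i ≡ 2 * hiB r t + 1)

-- the (t+1)-th layer of W  (layer r s 0 is the perimeter of W)
layer : ℕ → (EEdge → ℕ) → ℕ → Subgraph
layer r s t = spanned r s (LayerE r t)

-- the compass of the subwall S_t of W (part of W in the closed disk
-- bounded by the (t+1)-th layer)
compass : ℕ → (EEdge → ℕ) → ℕ → Subgraph
compass r s t = spanned r s (CompassE r t)

centralCompass : ℕ → (EEdge → ℕ) → ℕ → Subgraph
centralCompass r s q = compass r s ((r ∸ q) / 2)

OpenDisk : ℕ → (EEdge → ℕ) → ℕ → V → Set
OpenDisk r s t v = vtx (compass r s t) v × ¬ vtx (layer r s t) v

-- (C , P) is an (x,y)-railed annulus of W, where C = [layer 0, …, layer (x-1)]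
-- (the first x layers of W) and P = [P 0, …, P (y-1)].

RailedAnnulusOfLayers : ℕ → (EEdge → ℕ) → (x y : ℕ) → (Fin y → List V) → Set
RailedAnnulusOfLayers r s x y P =
  (∀ t → t < x → IsCycleGraph (layer r s t)) ×
  (∀ t t' → t < x → t' < x → t ≢ t' → ∀ v → vtx (layer r s t) v → vtx (layer r s t') v → ⊥) ×
  (∀ t → suc t < x → ∀ v → OpenDisk r s (suc t) v → OpenDisk r s t v) ×
  (∀ j → IsPathIn r s (P j)) ×
  (∀ j j' → j ≢ j' → ∀ v → v ∈ P j → v ∈ P j' → ⊥) ×
  -- each rail lies in the annulus: closure(D_1) \ D_x (D_1's closure is all of W)
  (∀ j → All (λ v → ¬ OpenDisk r s (x ∸ 1) v) (P j)) ×
  (∀ t j → t < x → IsPathGraph (layer r s t ∩G pathSubgraph (P j)))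

-- Write w = 2 x + k with k odd, k ≥ z and 4 (k + 1) ≥ y, and X = x - 1. The layer t of W is the
-- frame of the subwall S_t spanned by the rows t … w - 1 - t; it is traced by a closed walk made of
-- two rows and two vertical paths, and the frames are pairwise disjoint and nested because their
-- coordinate boxes are strictly nested. The rails come in four families of k + 1: the vertical
-- paths X … X + k from the bottom of W up to row X, the vertical paths X + 1 … X + k + 1 from the
-- top row of S_X to the top of W, the rows X … X + k from the left side of W to S_X, and the rows
-- X + 1 … X + k + 1 from S_X to the right side of W. Each rail crosses every layer t < X in a
-- single edge and touches the layer X in a single node, so it meets every layer in a path and
-- avoids the disk of layer X. Finally the central z-subwall is S_T with T > X, inside that disk.

module Submission where

open import Defs
open import Data.Bool using (true; false)
open import Data.Fin using (Fin; toℕ; inject≤; remQuot; combine)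
open import Data.Fin.Patterns using (0F; 1F; 2F; 3F)
open import Data.Fin.Properties using (toℕ-injective; toℕ≤pred[n]; inject≤-injective; combine-remQuot)
open import Data.Empty using (⊥; ⊥-elim)
open import Data.List using (List; []; _∷_; _++_; map; upTo; length; reverse)
open import Data.List.Properties using (++-assoc; map-++; length-++; ʳ++-defn; unfold-reverse; reverse-++; reverse-involutive; reverse-map; map-∘; map-cong)
open import Data.List.Membership.Propositional using (_∈_; _∉_)
open import Data.List.Membership.Propositional.Properties
  using (∈-map⁺; ∈-map⁻; ∈-++⁺ˡ; ∈-++⁺ʳ; ∈-++⁻; ∈-upTo⁺; ∈-upTo⁻)
open import Data.List.Relation.Unary.Any using (here; there)
import Data.List.Relation.Unary.Any.Properties as Any
open import Data.List.Relation.Unary.All using (All; []; _∷_; tabulate)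
open import Data.List.Relation.Unary.All.Properties using (¬Any⇒All¬)
import Data.List.Relation.Unary.AllPairs as AllPairs
open import Data.List.Relation.Unary.Unique.Propositional using (Unique; []; _∷_)
import Data.List.Relation.Unary.Unique.Propositional.Properties as Unique
open import Data.Nat
open import Data.Nat.Properties
open import Data.Nat.Tactic.RingSolver using (solve-∀)
open import Data.Nat.DivMod using (m%n<n; m≡m%n+[m/n]*n; m*n/n≡m)
open import Data.Product using (Σ; ∃; ∃₂; _×_; _,_; proj₁; proj₂; uncurry)
import Data.Product
open import Data.Sum using (_⊎_; inj₁; inj₂; [_,_]′)
open import Relation.Nullary using (¬_; yes; no)
open import Relation.Binary using (tri<; tri≈; tri>)
open import Relation.Binary.PropositionalEquality
open import Function using (_∘_)

module _ {A : Set} where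

  Step-++⁺ˡ : {xs ys : List A} {u v : A} → Step xs u v → Step (xs ++ ys) u v
  Step-++⁺ˡ here       = here
  Step-++⁺ˡ (there st) = there (Step-++⁺ˡ st)

  Step-++⁺ʳ : (xs : List A) {ys : List A} {u v : A} → Step ys u v → Step (xs ++ ys) u v
  Step-++⁺ʳ []       st = st
  Step-++⁺ʳ (x ∷ xs) st = there (Step-++⁺ʳ xs st)

  Step-++⁻ : (xs : List A) {y : A} {ys : List A} {u v : A} →
    Step (xs ++ y ∷ ys) u v → Step (xs ++ y ∷ []) u v ⊎ Step (y ∷ ys) u v
  Step-++⁻ []                here       = inj₂ here
  Step-++⁻ []                (there st) = inj₂ (there st)
  Step-++⁻ (x ∷ [])          here       = inj₁ here
  Step-++⁻ (x ∷ _ ∷ _)       here       = inj₁ here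
  Step-++⁻ (x ∷ xs)          (there st) with Step-++⁻ xs st
  ... | inj₁ p = inj₁ (there p)
  ... | inj₂ p = inj₂ p

  Step-++-∷⁺ : (xs : List A) {y : A} {ys : List A} {u v : A} →
    Step (xs ++ y ∷ []) u v → Step (xs ++ y ∷ ys) u v
  Step-++-∷⁺ []          (there ())
  Step-++-∷⁺ (x ∷ [])    here       = here
  Step-++-∷⁺ (x ∷ _ ∷ _) here       = here
  Step-++-∷⁺ (x ∷ xs)    (there st) = there (Step-++-∷⁺ xs st)

  Step-reverse : {L : List A} {u v : A} → Step L u v → Step (reverse L) v u
  Step-reverse (here {L = L}) = subst (λ M → Step M _ _) (sym (ʳ++-defn L)) (Step-++⁺ʳ (reverse L) here)
  Step-reverse (there {L = L} st) = subst (λ M → Step M _ _) (sym (ʳ++-defn L)) (Step-++⁺ˡ (Step-reverse st))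

  Step-∈ : {L : List A} {u v : A} → Step L u v → u ∈ L × v ∈ L
  Step-∈ here       = here refl , there (here refl)
  Step-∈ (there st) = there (proj₁ (Step-∈ st)) , there (proj₂ (Step-∈ st))

  Consec-sym : {L : List A} {u v : A} → Consec L u v → Consec L v u
  Consec-sym (inj₁ st) = inj₂ st
  Consec-sym (inj₂ st) = inj₁ st

  Consec-∈ : {L : List A} {u v : A} → Consec L u v → u ∈ L × v ∈ L
  Consec-∈ (inj₁ st) = Step-∈ st
  Consec-∈ (inj₂ st) = proj₂ (Step-∈ st) , proj₁ (Step-∈ st)

  Consec-reverse : {L : List A} {u v : A} → Consec L u v → Consec (reverse L) u v
  Consec-reverse (inj₁ st) = inj₂ (Step-reverse st)
  Consec-reverse (inj₂ st) = inj₁ (Step-reverse st)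

  unique-∷ : {x : A} {xs : List A} → x ∉ xs → Unique xs → Unique (x ∷ xs)
  unique-∷ x∉xs u = ¬Any⇒All¬ _ x∉xs ∷ u

  unique-head : {x : A} {xs : List A} → Unique (x ∷ xs) → x ∉ xs
  unique-head = Unique.Unique[x∷xs]⇒x∉xs

  unique-++⁻ˡ : (xs : List A) {ys : List A} → Unique (xs ++ ys) → Unique xs
  unique-++⁻ˡ []       u = []
  unique-++⁻ˡ (x ∷ xs) u = unique-∷ (λ m → unique-head u (∈-++⁺ˡ m)) (unique-++⁻ˡ xs (AllPairs.tail u))

  unique-reverse : {xs : List A} → Unique xs → Unique (reverse xs)
  unique-reverse {[]}     u = []
  unique-reverse {x ∷ xs} u = subst Unique (sym (unfold-reverse x xs))
    (Unique.++⁺ (unique-reverse (AllPairs.tail u)) (unique-∷ (λ ()) [])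
      λ { (m , here refl) → unique-head u (Any.reverse⁻ m) })

  Step-≢ : {L : List A} {u v : A} → Unique L → Step L u v → u ≢ v
  Step-≢ u here refl       = unique-head u (here refl)
  Step-≢ u (there st)      = Step-≢ (AllPairs.tail u) st

  Consec-≢ : {L : List A} {u v : A} → Unique L → Consec L u v → u ≢ v
  Consec-≢ u (inj₁ st)   = Step-≢ u st
  Consec-≢ u (inj₂ st) e = Step-≢ u st (sym e)

  length-++-≤ : (xs ys : List A) → length xs ≤ length (xs ++ ys)
  length-++-≤ xs ys = subst (length xs ≤_) (sym (length-++ xs)) (m≤m+n _ _)

  Consec-mono : {L L′ : List A} → (∀ {u v} → Step L u v → Step L′ u v) → ∀ {u v} → Consec L u v → Consec L′ u v
  Consec-mono f (inj₁ st) = inj₁ (f st)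
  Consec-mono f (inj₂ st) = inj₂ (f st)

-- Subdivided edges

interior : (EEdge → ℕ) → EEdge → List V
interior s e = map (mid e) (upTo (s e))

OnChain : (EEdge → ℕ) → EEdge → V → Set
OnChain s e v = v ≡ src e ⊎ v ≡ tgt e ⊎ ∃ λ k → v ≡ mid e k × k < s e

interior-∈⁻ : ∀ s e {v} → v ∈ interior s e → ∃ λ k → v ≡ mid e k × k < s e
interior-∈⁻ s e m with ∈-map⁻ (mid e) m
... | k , k∈ , eq = k , eq , ∈-upTo⁻ k∈

interior-∈⁺ : ∀ s e {k} → k < s e → mid e k ∈ interior s e
interior-∈⁺ s e lt = ∈-map⁺ (mid e) (∈-upTo⁺ lt)

chain-∈⁻ : ∀ s e {v} → v ∈ chain s e → OnChain s e v
chain-∈⁻ s e (here p) = inj₁ p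
chain-∈⁻ s e (there m) with ∈-++⁻ (interior s e) m
... | inj₁ q        = inj₂ (inj₂ (interior-∈⁻ s e q))
... | inj₂ (here p) = inj₂ (inj₁ p)

chain-∈⁺ : ∀ s e {v} → OnChain s e v → v ∈ chain s e
chain-∈⁺ s e (inj₁ p)                      = here p
chain-∈⁺ s e (inj₂ (inj₁ p))               = there (∈-++⁺ʳ (interior s e) (here p))
chain-∈⁺ s e (inj₂ (inj₂ (k , refl , lt))) = there (∈-++⁺ˡ (interior-∈⁺ s e lt))

src-∈-chain : ∀ s e → src e ∈ chain s e
src-∈-chain s e = here refl

tgt-∈-chain : ∀ s e → tgt e ∈ chain s e
tgt-∈-chain s e = chain-∈⁺ s e (inj₂ (inj₁ refl))

IsEndOf : EEdge → V → Set
IsEndOf e v = v ≡ src e ⊎ v ≡ tgt e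

end-∈-chain : ∀ s e {v} → IsEndOf e v → v ∈ chain s e
end-∈-chain s e (inj₁ refl) = src-∈-chain s e
end-∈-chain s e (inj₂ refl) = tgt-∈-chain s e

src≢mid : ∀ e {e′ k} → src e ≢ mid e′ k
src≢mid (hor i j) ()
src≢mid (ver i j) ()

tgt≢mid : ∀ e {e′ k} → tgt e ≢ mid e′ k
tgt≢mid (hor i j) ()
tgt≢mid (ver i j) ()

src≢tgt : ∀ e → src e ≢ tgt e
src≢tgt (hor i j) ()
src≢tgt (ver i j) ()

mid-∈-chain⁻ : ∀ s e {e′ k} → mid e′ k ∈ chain s e → e′ ≡ e × k < s e
mid-∈-chain⁻ s e m with chain-∈⁻ s e m
... | inj₁ eq                      = ⊥-elim (src≢mid e (sym eq))
... | inj₂ (inj₁ eq)               = ⊥-elim (tgt≢mid e (sym eq))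
... | inj₂ (inj₂ (k , refl , lt)) = refl , lt

node-∈-chain⁻ : ∀ s e {i j} → node i j ∈ chain s e → IsEndOf e (node i j)
node-∈-chain⁻ s e m with chain-∈⁻ s e m
... | inj₁ p               = inj₁ p
... | inj₂ (inj₁ p)        = inj₂ p
... | inj₂ (inj₂ (_ , () , _))

mid-injectiveˡ : ∀ {e e′ k k′} → mid e k ≡ mid e′ k′ → e ≡ e′
mid-injectiveˡ refl = refl

node-injective : ∀ {i j i′ j′} → node i j ≡ node i′ j′ → i ≡ i′ × j ≡ j′
node-injective refl = refl , refl

ends-injective : ∀ e e′ → src e ≡ src e′ → tgt e ≡ tgt e′ → e ≡ e′
ends-injective (hor i j) (hor .i .j) refl refl = refl
ends-injective (hor i j) (ver .i .j) refl q    = ⊥-elim (1+n≢n (proj₁ (node-injective q)))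
ends-injective (ver i j) (hor .i .j) refl q    = ⊥-elim (1+n≢n (sym (proj₁ (node-injective q))))
ends-injective (ver i j) (ver .i .j) refl refl = refl

weight : V → ℕ
weight (node i j) = i + j
weight (mid _ _)  = 0

weight-tgt : ∀ e → weight (tgt e) ≡ suc (weight (src e))
weight-tgt (hor i j) = refl
weight-tgt (ver i j) = +-suc i j

ends-not-swapped : ∀ e e′ → src e ≡ tgt e′ → tgt e ≡ src e′ → ⊥
ends-not-swapped e e′ p q = m≢1+n+m (weight (src e)) (begin
  weight (src e)               ≡⟨ cong weight p ⟩
  weight (tgt e′)              ≡⟨ weight-tgt e′ ⟩
  suc (weight (src e′))        ≡⟨ cong (suc ∘ weight) (sym q) ⟩
  suc (weight (tgt e))         ≡⟨ cong suc (weight-tgt e) ⟩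
  suc (suc (weight (src e)))   ∎)
  where open ≡-Reasoning

chains-sharing-two-vertices : ∀ s e e′ {u v} → u ≢ v →
  u ∈ chain s e → v ∈ chain s e → u ∈ chain s e′ → v ∈ chain s e′ → e ≡ e′
chains-sharing-two-vertices s e e′ {u} {v} u≢v u∈ v∈ u∈′ v∈′ =
  go (chain-∈⁻ s e u∈) (chain-∈⁻ s e v∈) (chain-∈⁻ s e′ u∈′) (chain-∈⁻ s e′ v∈′)
  where
  go : OnChain s e u → OnChain s e v → OnChain s e′ u → OnChain s e′ v → e ≡ e′
  go (inj₂ (inj₂ (_ , refl , _))) _ _ _ = proj₁ (mid-∈-chain⁻ s e′ u∈′)
  go _ (inj₂ (inj₂ (_ , refl , _))) _ _ = proj₁ (mid-∈-chain⁻ s e′ v∈′)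
  go _ _ (inj₂ (inj₂ (_ , refl , _))) _ = sym (proj₁ (mid-∈-chain⁻ s e u∈))
  go _ _ _ (inj₂ (inj₂ (_ , refl , _))) = sym (proj₁ (mid-∈-chain⁻ s e v∈))
  go (inj₁ a) (inj₁ b) _ _ = ⊥-elim (u≢v (trans a (sym b)))
  go (inj₂ (inj₁ a)) (inj₂ (inj₁ b)) _ _ = ⊥-elim (u≢v (trans a (sym b)))
  go _ _ (inj₁ a) (inj₁ b) = ⊥-elim (u≢v (trans a (sym b)))
  go _ _ (inj₂ (inj₁ a)) (inj₂ (inj₁ b)) = ⊥-elim (u≢v (trans a (sym b)))
  go (inj₁ a) (inj₂ (inj₁ b)) (inj₁ c) (inj₂ (inj₁ d)) = ends-injective e e′ (trans (sym a) c) (trans (sym b) d)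
  go (inj₁ a) (inj₂ (inj₁ b)) (inj₂ (inj₁ c)) (inj₁ d) = ⊥-elim (ends-not-swapped e e′ (trans (sym a) c) (trans (sym b) d))
  go (inj₂ (inj₁ a)) (inj₁ b) (inj₁ c) (inj₂ (inj₁ d)) = ⊥-elim (ends-not-swapped e e′ (trans (sym b) d) (trans (sym a) c))
  go (inj₂ (inj₁ a)) (inj₁ b) (inj₂ (inj₁ c)) (inj₁ d) = ends-injective e e′ (trans (sym b) d) (trans (sym a) c)

interior-unique : ∀ s e → Unique (interior s e)
interior-unique s e = Unique.map⁺ (λ { refl → refl }) (Unique.upTo⁺ (s e))

chain-unique : ∀ s e → Unique (chain s e)
chain-unique s e = unique-∷ src∉ (Unique.++⁺ (interior-unique s e) (unique-∷ (λ ()) []) disjoint)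
  where
  disjoint : ∀ {v} → ¬ (v ∈ interior s e × v ∈ tgt e ∷ [])
  disjoint (m , here refl) with interior-∈⁻ s e m
  ... | _ , eq , _ = tgt≢mid e eq
  src∉ : src e ∉ interior s e ++ tgt e ∷ []
  src∉ m with ∈-++⁻ (interior s e) m
  ... | inj₂ (here p) = src≢tgt e p
  ... | inj₁ q with interior-∈⁻ s e q
  ... | _ , eq , _ = src≢mid e eq

chains-sharing-an-edge : ∀ s e e′ {u v} → Consec (chain s e) u v → Consec (chain s e′) u v → e ≡ e′
chains-sharing-an-edge s e e′ c c′ =
  chains-sharing-two-vertices s e e′ (Consec-≢ (chain-unique s e) c)
    (proj₁ (Consec-∈ c)) (proj₂ (Consec-∈ c)) (proj₁ (Consec-∈ c′)) (proj₂ (Consec-∈ c′))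

-- Walks of the elementary wall

data Dart : Set where
  fwd bwd : EEdge → Dart

edgeOf : Dart → EEdge
edgeOf (fwd e) = e
edgeOf (bwd e) = e

from to : Dart → V
from (fwd e) = src e
from (bwd e) = tgt e
to (fwd e) = tgt e
to (bwd e) = src e

flip : Dart → Dart
flip (fwd e) = bwd e
flip (bwd e) = fwd e

-- The last vertex is left out so that the bodies of consecutive darts concatenate to a path.
body : (EEdge → ℕ) → Dart → List V
body s (fwd e) = src e ∷ interior s e
body s (bwd e) = tgt e ∷ reverse (interior s e)

Walk : V → List Dart → V → Set
Walk a []       b = a ≡ b
Walk a (d ∷ ds) b = a ≡ from d × Walk (to d) ds b

walkPath : (EEdge → ℕ) → List Dart → V → List V
walkPath s []       b = b ∷ []
walkPath s (d ∷ ds) b = body s d ++ walkPath s ds b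

walkCycle : (EEdge → ℕ) → List Dart → List V
walkCycle s []       = []
walkCycle s (d ∷ ds) = body s d ++ walkCycle s ds

walkNodes : List Dart → V → List V
walkNodes ds b = map from ds ++ b ∷ []

IsNode : V → Set
IsNode v = ∃₂ λ i j → v ≡ node i j

NodeWith : V → (ℕ → ℕ → Set) → Set
NodeWith v Q = ∃₂ λ i j → v ≡ node i j × Q i j

IsNode⇒≢mid : ∀ {v e k} → IsNode v → v ≢ mid e k
IsNode⇒≢mid (_ , _ , refl) ()

from-IsNode : ∀ d → IsNode (from d)
from-IsNode (fwd (hor i j)) = _ , _ , refl
from-IsNode (fwd (ver i j)) = _ , _ , refl
from-IsNode (bwd (hor i j)) = _ , _ , refl
from-IsNode (bwd (ver i j)) = _ , _ , refl

to-IsNode : ∀ d → IsNode (to d)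
to-IsNode d = subst IsNode (to≡from-flip d) (from-IsNode (flip d))
  where
  to≡from-flip : ∀ d → from (flip d) ≡ to d
  to≡from-flip (fwd e) = refl
  to≡from-flip (bwd e) = refl

from≢to : ∀ d → from d ≢ to d
from≢to (fwd e) p = src≢tgt e p
from≢to (bwd e) p = src≢tgt e (sym p)

from-∈-chain : ∀ s d → from d ∈ chain s (edgeOf d)
from-∈-chain s (fwd e) = src-∈-chain s e
from-∈-chain s (bwd e) = tgt-∈-chain s e

to-∈-chain : ∀ s d → to d ∈ chain s (edgeOf d)
to-∈-chain s (fwd e) = tgt-∈-chain s e
to-∈-chain s (bwd e) = src-∈-chain s e

body-∈⁻ : ∀ s d {v} → v ∈ body s d → v ≡ from d ⊎ ∃ λ k → v ≡ mid (edgeOf d) k × k < s (edgeOf d)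
body-∈⁻ s (fwd e) (here p)  = inj₁ p
body-∈⁻ s (fwd e) (there m) = inj₂ (interior-∈⁻ s e m)
body-∈⁻ s (bwd e) (here p)  = inj₁ p
body-∈⁻ s (bwd e) (there m) = inj₂ (interior-∈⁻ s e (Any.reverse⁻ m))

body⊆chain : ∀ s d {v} → v ∈ body s d → v ∈ chain s (edgeOf d)
body⊆chain s d m with body-∈⁻ s d m
... | inj₁ refl             = from-∈-chain s d
... | inj₂ (k , refl , lt) = chain-∈⁺ s (edgeOf d) (inj₂ (inj₂ (k , refl , lt)))

chain⊆body : ∀ s d {v} → v ∈ chain s (edgeOf d) → v ∈ body s d ⊎ v ≡ to d
chain⊆body s (fwd e) m with chain-∈⁻ s e m
... | inj₁ refl                    = inj₁ (here refl)
... | inj₂ (inj₁ refl)             = inj₂ refl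
... | inj₂ (inj₂ (k , refl , lt)) = inj₁ (there (interior-∈⁺ s e lt))
chain⊆body s (bwd e) m with chain-∈⁻ s e m
... | inj₁ refl                    = inj₂ refl
... | inj₂ (inj₁ refl)             = inj₁ (here refl)
... | inj₂ (inj₂ (k , refl , lt)) = inj₁ (there (Any.reverse⁺ (interior-∈⁺ s e lt)))

body-unique : ∀ s d → Unique (body s d)
body-unique s (fwd e) = unique-∷ src∉ (interior-unique s e)
  where
  src∉ : src e ∉ interior s e
  src∉ m with interior-∈⁻ s e m
  ... | _ , eq , _ = src≢mid e eq
body-unique s (bwd e) = unique-∷ tgt∉ (unique-reverse (interior-unique s e))
  where
  tgt∉ : tgt e ∉ reverse (interior s e)
  tgt∉ m with interior-∈⁻ s e (Any.reverse⁻ m)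
  ... | _ , eq , _ = tgt≢mid e eq

reverse-chain : ∀ s e → reverse (chain s e) ≡ body s (bwd e) ++ src e ∷ []
reverse-chain s e = begin
  reverse (chain s e)                                           ≡⟨ unfold-reverse (src e) (interior s e ++ tgt e ∷ []) ⟩
  reverse (interior s e ++ tgt e ∷ []) ++ src e ∷ []            ≡⟨ cong (_++ src e ∷ []) (reverse-++ (interior s e) (tgt e ∷ [])) ⟩
  tgt e ∷ reverse (interior s e) ++ src e ∷ []                  ∎
  where open ≡-Reasoning

dartPath : (EEdge → ℕ) → Dart → List V
dartPath s d = body s d ++ to d ∷ []

Consec-dartPath⁻ : ∀ s d {u v} → Consec (dartPath s d) u v → Consec (chain s (edgeOf d)) u v
Consec-dartPath⁻ s (fwd e) c = c
Consec-dartPath⁻ s (bwd e) {u} {v} c =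
  subst (λ L → Consec L u v) (reverse-involutive (chain s e))
    (Consec-reverse (subst (λ L → Consec L u v) (sym (reverse-chain s e)) c))

Consec-dartPath⁺ : ∀ s d {u v} → Consec (chain s (edgeOf d)) u v → Consec (dartPath s d) u v
Consec-dartPath⁺ s (fwd e) c = c
Consec-dartPath⁺ s (bwd e) {u} {v} c = subst (λ L → Consec L u v) (reverse-chain s e) (Consec-reverse c)

walkPath-head : ∀ s {a} ds {b} → Walk a ds b → ∃ λ rest → walkPath s ds b ≡ a ∷ rest
walkPath-head s []           refl       = [] , refl
walkPath-head s (fwd e ∷ ds) (refl , _) = _ , refl
walkPath-head s (bwd e ∷ ds) (refl , _) = _ , refl

walkPath-Step⁻ : ∀ s {a} ds {b u v} → Walk a ds b → Step (walkPath s ds b) u v →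
  ∃ λ d → d ∈ ds × Consec (chain s (edgeOf d)) u v
walkPath-Step⁻ s []       refl       (there ())
walkPath-Step⁻ s (d ∷ ds) {b} {u} {v} (refl , w) st with walkPath-head s ds w
... | rest , eq with Step-++⁻ (body s d) (subst (λ L → Step (body s d ++ L) u v) eq st)
... | inj₁ p = d , here refl , Consec-dartPath⁻ s d (inj₁ p)
... | inj₂ p with walkPath-Step⁻ s ds w (subst (λ L → Step L u v) (sym eq) p)
... | d′ , d′∈ , c = d′ , there d′∈ , c

walkPath-Consec⁻ : ∀ s {a} ds {b u v} → Walk a ds b → Consec (walkPath s ds b) u v →
  ∃ λ d → d ∈ ds × Consec (chain s (edgeOf d)) u v
walkPath-Consec⁻ s ds w (inj₁ st) = walkPath-Step⁻ s ds w st
walkPath-Consec⁻ s ds w (inj₂ st) with walkPath-Step⁻ s ds w st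
... | d , d∈ , c = d , d∈ , Consec-sym c

walkPath-Consec⁺ : ∀ s {a} ds {b u v d} → Walk a ds b → d ∈ ds →
  Consec (chain s (edgeOf d)) u v → Consec (walkPath s ds b) u v
walkPath-Consec⁺ s (d ∷ ds) {b} {u} {v} (refl , w) (here refl) c with walkPath-head s ds w
... | rest , eq = subst (λ L → Consec (body s d ++ L) u v) (sym eq)
                    (Consec-mono (Step-++-∷⁺ (body s d)) (Consec-dartPath⁺ s d c))
walkPath-Consec⁺ s (d′ ∷ ds) (refl , w) (there d∈) c =
  Consec-mono (Step-++⁺ʳ (body s d′)) (walkPath-Consec⁺ s ds w d∈ c)

walkPath-∈⁻ : ∀ s ds {b v} → v ∈ walkPath s ds b → (∃ λ d → d ∈ ds × v ∈ body s d) ⊎ v ≡ b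
walkPath-∈⁻ s []       (here p) = inj₂ p
walkPath-∈⁻ s (d ∷ ds) m with ∈-++⁻ (body s d) m
... | inj₁ p = inj₁ (d , here refl , p)
... | inj₂ p with walkPath-∈⁻ s ds p
... | inj₁ (d′ , d′∈ , q) = inj₁ (d′ , there d′∈ , q)
... | inj₂ q              = inj₂ q

end-∈-walkPath : ∀ s ds {b} → b ∈ walkPath s ds b
end-∈-walkPath s []       = here refl
end-∈-walkPath s (d ∷ ds) = ∈-++⁺ʳ (body s d) (end-∈-walkPath s ds)

walkPath-∈⁺ : ∀ s {a} ds {b v d} → Walk a ds b → d ∈ ds → v ∈ chain s (edgeOf d) → v ∈ walkPath s ds b
walkPath-∈⁺ s (d ∷ ds) (refl , w) (here refl) m with chain⊆body s d m
... | inj₁ p = ∈-++⁺ˡ p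
... | inj₂ refl with walkPath-head s ds w
... | rest , eq = ∈-++⁺ʳ (body s d) (subst (_ ∈_) (sym eq) (here refl))
walkPath-∈⁺ s (d′ ∷ ds) (refl , w) (there d∈) m = ∈-++⁺ʳ (body s d′) (walkPath-∈⁺ s ds w d∈ m)

dart-ends-∈-walkNodes : ∀ {a} ds {b d} → Walk a ds b → d ∈ ds →
  from d ∈ walkNodes ds b × to d ∈ walkNodes ds b
dart-ends-∈-walkNodes (d ∷ [])      (refl , refl)     (here refl) = here refl , there (here refl)
dart-ends-∈-walkNodes (d ∷ d′ ∷ ds) (refl , (p , w)) (here refl) =
  here refl , there (subst (_∈ walkNodes (d′ ∷ ds) _) (sym p) (here refl))
dart-ends-∈-walkNodes (d′ ∷ ds)     (refl , w)        (there d∈) =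
  Data.Product.map there there (dart-ends-∈-walkNodes ds w d∈)

walkNodes-IsNode : ∀ {a} ds {b v} → Walk a ds b → IsNode a → v ∈ walkNodes ds b → IsNode v
walkNodes-IsNode ds {b} w a-node m with ∈-++⁻ (map from ds) m
... | inj₂ (here refl) = end-IsNode ds w a-node
  where
  end-IsNode : ∀ {a} ds {b} → Walk a ds b → IsNode a → IsNode b
  end-IsNode []       refl     n = n
  end-IsNode (d ∷ ds) (_ , w)  _ = end-IsNode ds w (to-IsNode d)
... | inj₁ q with ∈-map⁻ from q
... | d , _ , refl = from-IsNode d

walkPath-∈-classify : ∀ s {a} ds {b v} → Walk a ds b → v ∈ walkPath s ds b →
  v ∈ walkNodes ds b ⊎ ∃₂ λ e k → v ≡ mid e k × e ∈ map edgeOf ds × k < s e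
walkPath-∈-classify s ds {b} w m with walkPath-∈⁻ s ds m
... | inj₂ refl = inj₁ (∈-++⁺ʳ (map from ds) (here refl))
... | inj₁ (d , d∈ , q) with body-∈⁻ s d q
... | inj₁ refl             = inj₁ (proj₁ (dart-ends-∈-walkNodes ds w d∈))
... | inj₂ (k , refl , lt) = inj₂ (edgeOf d , k , refl , ∈-map⁺ edgeOf d∈ , lt)

walkNodes⊆walkPath : ∀ s {a} ds {b v} → Walk a ds b → v ∈ walkNodes ds b → v ∈ walkPath s ds b
walkNodes⊆walkPath s ds {b} w m with ∈-++⁻ (map from ds) m
... | inj₂ (here refl) = end-∈-walkPath s ds
... | inj₁ q with ∈-map⁻ from q
... | d , d∈ , refl = walkPath-∈⁺ s ds w d∈ (from-∈-chain s d)

walkPath-unique : ∀ s {a} ds {b} → Walk a ds b → Unique (walkNodes ds b) → Unique (map edgeOf ds) →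
  Unique (walkPath s ds b)
walkPath-unique s []       w          _ _ = unique-∷ (λ ()) []
walkPath-unique s (d ∷ ds) {b} (refl , w) un ue =
  Unique.++⁺ (body-unique s d) (walkPath-unique s ds w (AllPairs.tail un) (AllPairs.tail ue)) disjoint
  where
  disjoint : ∀ {v} → ¬ (v ∈ body s d × v ∈ walkPath s ds b)
  disjoint (m₁ , m₂) with body-∈⁻ s d m₁ | walkPath-∈-classify s ds w m₂
  ... | inj₁ refl            | inj₁ q                       = unique-head un q
  ... | inj₁ refl            | inj₂ (_ , _ , eq , _)        = IsNode⇒≢mid (from-IsNode d) eq
  ... | inj₂ (_ , refl , _)  | inj₁ q                       = IsNode⇒≢mid (walkNodes-IsNode ds w (to-IsNode d) q) refl
  ... | inj₂ (_ , refl , _)  | inj₂ (_ , _ , refl , e∈ , _) = unique-head ue e∈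

same-edge-ends : ∀ d d′ → edgeOf d ≡ edgeOf d′ →
  (from d ≡ from d′ × to d ≡ to d′) ⊎ (from d ≡ to d′ × to d ≡ from d′)
same-edge-ends (fwd e) (fwd .e) refl = inj₁ (refl , refl)
same-edge-ends (fwd e) (bwd .e) refl = inj₂ (refl , refl)
same-edge-ends (bwd e) (fwd .e) refl = inj₂ (refl , refl)
same-edge-ends (bwd e) (bwd .e) refl = inj₁ (refl , refl)

path-edges-unique : ∀ {a} ds {b} → Walk a ds b → Unique (walkNodes ds b) → Unique (map edgeOf ds)
path-edges-unique []       w          un = []
path-edges-unique (d ∷ ds) {b} (refl , w) un = unique-∷ e∉ (path-edges-unique ds w (AllPairs.tail un))
  where
  e∉ : edgeOf d ∉ map edgeOf ds
  e∉ m with ∈-map⁻ edgeOf m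
  ... | d′ , d′∈ , eq with same-edge-ends d d′ eq
  ... | inj₁ (p , _) = unique-head un (subst (_∈ walkNodes ds b) (sym p) (proj₁ (dart-ends-∈-walkNodes ds w d′∈)))
  ... | inj₂ (p , _) = unique-head un (subst (_∈ walkNodes ds b) (sym p) (proj₂ (dart-ends-∈-walkNodes ds w d′∈)))

walkCycle-++ : ∀ s ds b → walkCycle s ds ++ b ∷ [] ≡ walkPath s ds b
walkCycle-++ s []       b = refl
walkCycle-++ s (d ∷ ds) b = trans (++-assoc (body s d) (walkCycle s ds) (b ∷ [])) (cong (body s d ++_) (walkCycle-++ s ds b))

walkCycle-∈⁻ : ∀ s ds {v} → v ∈ walkCycle s ds → ∃ λ d → d ∈ ds × v ∈ body s d
walkCycle-∈⁻ s (d ∷ ds) m with ∈-++⁻ (body s d) m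
... | inj₁ p = d , here refl , p
... | inj₂ p with walkCycle-∈⁻ s ds p
... | d′ , d′∈ , q = d′ , there d′∈ , q

from-∈-walkCycle : ∀ s ds {d} → d ∈ ds → from d ∈ walkCycle s ds
from-∈-walkCycle s (fwd e ∷ ds) (here refl) = here refl
from-∈-walkCycle s (bwd e ∷ ds) (here refl) = here refl
from-∈-walkCycle s (d′ ∷ ds)    (there d∈)  = ∈-++⁺ʳ (body s d′) (from-∈-walkCycle s ds d∈)

walkCycle-unique : ∀ s ds → Unique (map from ds) → Unique (map edgeOf ds) → Unique (walkCycle s ds)
walkCycle-unique s []       _  _  = []
walkCycle-unique s (d ∷ ds) un ue =
  Unique.++⁺ (body-unique s d) (walkCycle-unique s ds (AllPairs.tail un) (AllPairs.tail ue)) disjoint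
  where
  disjoint : ∀ {v} → ¬ (v ∈ body s d × v ∈ walkCycle s ds)
  disjoint (m₁ , m₂) with walkCycle-∈⁻ s ds m₂
  ... | d′ , d′∈ , q with body-∈⁻ s d m₁ | body-∈⁻ s d′ q
  ... | inj₁ refl           | inj₁ p                = unique-head un (subst (_∈ map from ds) (sym p) (∈-map⁺ from d′∈))
  ... | inj₁ refl           | inj₂ (_ , eq , _)     = IsNode⇒≢mid (from-IsNode d) eq
  ... | inj₂ (_ , refl , _) | inj₁ p                = IsNode⇒≢mid (from-IsNode d′) (sym p)
  ... | inj₂ (_ , refl , _) | inj₂ (_ , eq , _)     =
    unique-head ue (subst (_∈ map edgeOf ds) (sym (mid-injectiveˡ eq)) (∈-map⁺ edgeOf d′∈))

closedWalk-edges-unique : ∀ d ds → Walk (to d) ds (from d) → Unique (map from (d ∷ ds)) → 2 ≤ length ds →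
  Unique (map edgeOf (d ∷ ds))
closedWalk-edges-unique d ds w un l = unique-∷ e∉ (path-edges-unique ds w tail-unique)
  where
  tail-unique : Unique (walkNodes ds (from d))
  tail-unique = Unique.++⁺ (AllPairs.tail un) (unique-∷ (λ ()) []) λ { (m , here refl) → unique-head un m }
  not-reversed : ∀ ds {d′} → Walk (to d) ds (from d) → Unique (map from (d ∷ ds)) → 2 ≤ length ds →
    d′ ∈ ds → from d ≡ to d′ → to d ≡ from d′ → ⊥
  not-reversed (d₁ ∷ d₂ ∷ _) (_ , r , _) un _ (here refl) p _ = unique-head un (there (here (trans p r)))
  not-reversed (d₁ ∷ [])     _           _ (s≤s ()) _ _ _
  not-reversed (d₁ ∷ ds)     (r , _)     un _ (there d′∈) _ q =
    unique-head (AllPairs.tail un) (subst (_∈ map from ds) (trans (sym q) r) (∈-map⁺ from d′∈))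
  e∉ : edgeOf d ∉ map edgeOf ds
  e∉ m with ∈-map⁻ edgeOf m
  ... | d′ , d′∈ , eq with same-edge-ends d d′ eq
  ... | inj₁ (p , _) = unique-head un (subst (_∈ map from ds) (sym p) (∈-map⁺ from d′∈))
  ... | inj₂ (p , q) = not-reversed ds w un l d′∈ p q

length-walkCycle : ∀ s ds → length ds ≤ length (walkCycle s ds)
length-walkCycle s []       = z≤n
length-walkCycle s (d ∷ ds) =
  subst (suc (length ds) ≤_) (sym (length-++ (body s d))) (+-mono-≤ (body-nonempty d) (length-walkCycle s ds))
  where
  body-nonempty : ∀ d → 1 ≤ length (body s d)
  body-nonempty (fwd e) = s≤s z≤n
  body-nonempty (bwd e) = s≤s z≤n

Traces : ℕ → (EEdge → Set) → List Dart → Set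
Traces r P ds = (∀ {d} → d ∈ ds → ValidEdge r (edgeOf d) × P (edgeOf d)) × (∀ e → ValidEdge r e → P e → e ∈ map edgeOf ds)

closedWalk-IsCycleGraph : ∀ r s (P : EEdge → Set) {a} ds → Walk a ds a → Unique (map from ds) → 3 ≤ length ds →
  Traces r P ds → IsCycleGraph (spanned r s P)
closedWalk-IsCycleGraph r s P (d ∷ ds) w@(refl , w′) un (s≤s l) (sound , complete) =
  L , ≤-trans (s≤s l) (length-walkCycle s (d ∷ ds)) ,
  walkCycle-unique s (d ∷ ds) un (closedWalk-edges-unique d ds w′ un l) , vertices , edges
  where
  L : List V
  L = walkCycle s (d ∷ ds)
  closing : ∀ {u v} → CConsec L u v ≡ Consec (walkPath s (d ∷ ds) (from d)) u v
  closing {u} {v} = trans (closes d) (cong (λ M → Consec M u v) (walkCycle-++ s (d ∷ ds) (from d)))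
    where
    closes : ∀ d → CConsec (walkCycle s (d ∷ ds)) u v ≡ Consec (walkCycle s (d ∷ ds) ++ from d ∷ []) u v
    closes (fwd e) = refl
    closes (bwd e) = refl
  vertices : ∀ v → Iff (vtx (spanned r s P) v) (v ∈ L)
  vertices v = to-L , from-L
    where
    to-L : vtx (spanned r s P) v → v ∈ L
    to-L (e , valid , pe , m) with ∈-map⁻ edgeOf (complete e valid pe)
    ... | d′ , d′∈ , refl with ∈-++⁻ L (subst (v ∈_) (sym (walkCycle-++ s (d ∷ ds) (from d))) (walkPath-∈⁺ s (d ∷ ds) w d′∈ m))
    ... | inj₁ q         = q
    ... | inj₂ (here refl) = from-∈-walkCycle s (d ∷ ds) (here refl)
    from-L : v ∈ L → vtx (spanned r s P) v
    from-L m with walkCycle-∈⁻ s (d ∷ ds) m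
    ... | d′ , d′∈ , q = edgeOf d′ , proj₁ (sound d′∈) , proj₂ (sound d′∈) , body⊆chain s d′ q
  edges : ∀ u v → Iff (edg (spanned r s P) u v) (CConsec L u v)
  edges u v = to-L , from-L
    where
    to-L : edg (spanned r s P) u v → CConsec L u v
    to-L (e , valid , pe , c) with ∈-map⁻ edgeOf (complete e valid pe)
    ... | d′ , d′∈ , refl = subst (λ A → A) (sym closing) (walkPath-Consec⁺ s (d ∷ ds) w d′∈ c)
    from-L : CConsec L u v → edg (spanned r s P) u v
    from-L cc with walkPath-Consec⁻ s (d ∷ ds) w (subst (λ A → A) closing cc)
    ... | d′ , d′∈ , c = edgeOf d′ , proj₁ (sound d′∈) , proj₂ (sound d′∈) , c

chain-WVertex : ∀ r s e {v} → ValidEdge r e → v ∈ chain s e → WVertex r s v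
chain-WVertex r s e valid m with chain-∈⁻ s e m
chain-WVertex r s (hor i j) valid m | inj₁ refl                   = proj₁ valid
chain-WVertex r s (ver i j) valid m | inj₁ refl                   = proj₁ valid
chain-WVertex r s (hor i j) valid m | inj₂ (inj₁ refl)            = proj₂ valid
chain-WVertex r s (ver i j) valid m | inj₂ (inj₁ refl)            = proj₁ (proj₂ valid)
chain-WVertex r s e         valid m | inj₂ (inj₂ (k , refl , lt)) = valid , lt

walk-end : ∀ {a} d ds {b} → Walk a (d ∷ ds) b → ∃ λ d′ → d′ ∈ d ∷ ds × b ≡ to d′
walk-end d []        (_ , refl) = d , here refl , refl
walk-end d (d′ ∷ ds) (_ , w)    with walk-end d′ ds w
... | d″ , d″∈ , eq = d″ , there d″∈ , eq

walkPath-IsPathIn : ∀ r s {a} ds {b} → Walk a ds b → 1 ≤ length ds → Unique (walkNodes ds b) →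
  (∀ {d} → d ∈ ds → ValidEdge r (edgeOf d)) → IsPathIn r s (walkPath s ds b)
walkPath-IsPathIn r s (d ∷ ds) {b} w _ un valid =
  nonempty , walkPath-unique s (d ∷ ds) w un (path-edges-unique (d ∷ ds) w un) , tabulate vertex , step
  where
  nonempty : walkPath s (d ∷ ds) b ≢ []
  nonempty eq with walkPath-head s (d ∷ ds) w
  ... | _ , eq′ with trans (sym eq) eq′
  ... | ()
  vertex : ∀ {v} → v ∈ walkPath s (d ∷ ds) b → WVertex r s v
  vertex m with walkPath-∈⁻ s (d ∷ ds) m
  ... | inj₁ (d′ , d′∈ , q) = chain-WVertex r s (edgeOf d′) (valid d′∈) (body⊆chain s d′ q)
  ... | inj₂ refl with walk-end d ds w
  ... | d′ , d′∈ , refl = chain-WVertex r s (edgeOf d′) (valid d′∈) (to-∈-chain s d′)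
  step : ∀ u v → Step (walkPath s (d ∷ ds) b) u v → WAdj r s u v
  step u v st with walkPath-Step⁻ s (d ∷ ds) w st
  ... | d′ , d′∈ , c = edgeOf d′ , valid d′∈ , c

spanned∩walkPath-edge : ∀ r s (P : EEdge → Set) {a} ds {b} → Walk a ds b →
  (e : EEdge) → ValidEdge r e → P e → e ∈ map edgeOf ds →
  (∀ {v} → v ∈ walkNodes ds b → vtx (spanned r s P) v → IsEndOf e v) →
  IsPathGraph (spanned r s P ∩G pathSubgraph (walkPath s ds b))
spanned∩walkPath-edge r s P ds {b} w e valid pe e∈ only-ends =
  chain s e , (λ ()) , chain-unique s e , vertices , edges
  where
  only-e : ∀ {e′} → e′ ∈ map edgeOf ds → ValidEdge r e′ → P e′ → e′ ≡ e
  only-e m valid′ p′ with ∈-map⁻ edgeOf m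
  ... | d , d∈ , refl =
    chains-sharing-two-vertices s (edgeOf d) e (from≢to d) (from-∈-chain s d) (to-∈-chain s d)
      (end-∈-chain s e (only-ends (proj₁ (dart-ends-∈-walkNodes ds w d∈)) (edgeOf d , valid′ , p′ , from-∈-chain s d)))
      (end-∈-chain s e (only-ends (proj₂ (dart-ends-∈-walkNodes ds w d∈)) (edgeOf d , valid′ , p′ , to-∈-chain s d)))
  vertices : ∀ v → Iff (vtx (spanned r s P ∩G pathSubgraph (walkPath s ds b)) v) (v ∈ chain s e)
  vertices v = to-chain , from-chain
    where
    to-chain : vtx (spanned r s P ∩G pathSubgraph (walkPath s ds b)) v → v ∈ chain s e
    to-chain (sp , mp) with walkPath-∈-classify s ds w mp
    ... | inj₁ q = end-∈-chain s e (only-ends q sp)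
    ... | inj₂ (e₂ , k , refl , e₂∈ , lt) with sp
    ... | e₃ , valid₃ , p₃ , m₃ with mid-∈-chain⁻ s e₃ m₃
    ... | refl , _ with only-e e₂∈ valid₃ p₃
    ... | refl = chain-∈⁺ s e (inj₂ (inj₂ (k , refl , lt)))
    from-chain : v ∈ chain s e → vtx (spanned r s P ∩G pathSubgraph (walkPath s ds b)) v
    from-chain m with ∈-map⁻ edgeOf e∈
    ... | d , d∈ , refl = (e , valid , pe , m) , walkPath-∈⁺ s ds w d∈ m
  edges : ∀ u v → Iff (edg (spanned r s P ∩G pathSubgraph (walkPath s ds b)) u v) (Consec (chain s e) u v)
  edges u v = to-chain , from-chain
    where
    to-chain : edg (spanned r s P ∩G pathSubgraph (walkPath s ds b)) u v → Consec (chain s e) u v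
    to-chain ((e₃ , valid₃ , p₃ , c₃) , cp) with walkPath-Consec⁻ s ds w cp
    ... | d , d∈ , c with chains-sharing-an-edge s e₃ (edgeOf d) c₃ c
    ... | refl with only-e (∈-map⁺ edgeOf d∈) valid₃ p₃
    ... | refl = c
    from-chain : Consec (chain s e) u v → edg (spanned r s P ∩G pathSubgraph (walkPath s ds b)) u v
    from-chain c with ∈-map⁻ edgeOf e∈
    ... | d , d∈ , refl = (e , valid , pe , c) , walkPath-Consec⁺ s ds w d∈ c

spanned∩walkPath-node : ∀ r s (P : EEdge → Set) {a} ds {b} → Walk a ds b →
  (n : V) → n ∈ walkNodes ds b → vtx (spanned r s P) n →
  (∀ {v} → v ∈ walkNodes ds b → vtx (spanned r s P) v → v ≡ n) →
  IsPathGraph (spanned r s P ∩G pathSubgraph (walkPath s ds b))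
spanned∩walkPath-node r s P ds {b} w n n∈ n-sp only-n =
  n ∷ [] , (λ ()) , unique-∷ (λ ()) [] , vertices , edges
  where
  no-edge : ∀ {e} → e ∈ map edgeOf ds → ValidEdge r e → P e → ⊥
  no-edge m valid p with ∈-map⁻ edgeOf m
  ... | d , d∈ , refl =
    from≢to d (trans (only-n (proj₁ (dart-ends-∈-walkNodes ds w d∈)) (edgeOf d , valid , p , from-∈-chain s d))
                 (sym (only-n (proj₂ (dart-ends-∈-walkNodes ds w d∈)) (edgeOf d , valid , p , to-∈-chain s d))))
  vertices : ∀ v → Iff (vtx (spanned r s P ∩G pathSubgraph (walkPath s ds b)) v) (v ∈ n ∷ [])
  vertices v = to-n , from-n
    where
    to-n : vtx (spanned r s P ∩G pathSubgraph (walkPath s ds b)) v → v ∈ n ∷ []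
    to-n (sp , mp) with walkPath-∈-classify s ds w mp
    ... | inj₁ q = here (only-n q sp)
    ... | inj₂ (e₂ , k , refl , e₂∈ , lt) with sp
    ... | e₃ , valid₃ , p₃ , m₃ with mid-∈-chain⁻ s e₃ m₃
    ... | refl , _ = ⊥-elim (no-edge e₂∈ valid₃ p₃)
    from-n : v ∈ n ∷ [] → vtx (spanned r s P ∩G pathSubgraph (walkPath s ds b)) v
    from-n (here refl) = n-sp , walkNodes⊆walkPath s ds w n∈
  edges : ∀ u v → Iff (edg (spanned r s P ∩G pathSubgraph (walkPath s ds b)) u v) (Consec (n ∷ []) u v)
  edges u v = to-n , from-n
    where
    to-n : edg (spanned r s P ∩G pathSubgraph (walkPath s ds b)) u v → Consec (n ∷ []) u v
    to-n ((e₃ , valid₃ , p₃ , c₃) , cp) with walkPath-Consec⁻ s ds w cp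
    ... | d , d∈ , c with chains-sharing-an-edge s e₃ (edgeOf d) c₃ c
    ... | refl = ⊥-elim (no-edge (∈-map⁺ edgeOf d∈) valid₃ p₃)
    from-n : Consec (n ∷ []) u v → edg (spanned r s P ∩G pathSubgraph (walkPath s ds b)) u v
    from-n (inj₁ (there ()))
    from-n (inj₂ (there ()))

Walk-subst : ∀ {a a′} ds {b b′} → a ≡ a′ → b ≡ b′ → Walk a ds b → Walk a′ ds b′
Walk-subst ds refl refl w = w

Walk-++ : ∀ {a} ds {b ds′ c} → Walk a ds b → Walk b ds′ c → Walk a (ds ++ ds′) c
Walk-++ []       refl    w′ = w′
Walk-++ (d ∷ ds) (p , w) w′ = p , Walk-++ ds w w′

walkNodes-++ : ∀ ds ds′ c → walkNodes (ds ++ ds′) c ≡ map from ds ++ walkNodes ds′ c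
walkNodes-++ ds ds′ c = trans (cong (_++ c ∷ []) (map-++ from ds ds′)) (++-assoc (map from ds) (map from ds′) (c ∷ []))

walkNodes-∈⁻ : ∀ {a} ds {b v} → Walk a ds b → v ∈ walkNodes ds b → v ≡ a ⊎ ∃ λ d → d ∈ ds × v ≡ to d
walkNodes-∈⁻ []       refl       (here p)  = inj₁ p
walkNodes-∈⁻ (d ∷ ds) (refl , w) (here p)  = inj₁ p
walkNodes-∈⁻ (d ∷ ds) (refl , w) (there m) with walkNodes-∈⁻ ds w m
... | inj₁ p              = inj₂ (d , here refl , p)
... | inj₂ (d′ , d′∈ , p) = inj₂ (d′ , there d′∈ , p)

walkNodes-start : ∀ {a} ds {b} → Walk a ds b → walkNodes ds b ≡ a ∷ map to ds
walkNodes-start []       refl       = refl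
walkNodes-start (d ∷ ds) (refl , w) = cong (from d ∷_) (walkNodes-start ds w)

start-∈-walkNodes : ∀ {a} ds {b} → Walk a ds b → a ∈ walkNodes ds b
start-∈-walkNodes ds w = subst (_ ∈_) (sym (walkNodes-start ds w)) (here refl)

end-∈-walkNodes : ∀ ds {b} → b ∈ walkNodes ds b
end-∈-walkNodes ds = ∈-++⁺ʳ (map from ds) (here refl)

src-∈-walkNodes : ∀ {a} ds {b e} → Walk a ds b → e ∈ map edgeOf ds → src e ∈ walkNodes ds b
src-∈-walkNodes ds w m with ∈-map⁻ edgeOf m
... | fwd e , d∈ , refl = proj₁ (dart-ends-∈-walkNodes ds w d∈)
... | bwd e , d∈ , refl = proj₂ (dart-ends-∈-walkNodes ds w d∈)

edgeOf-++⁺ : ∀ ds ds′ {e} → e ∈ map edgeOf ds ⊎ e ∈ map edgeOf ds′ → e ∈ map edgeOf (ds ++ ds′)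
edgeOf-++⁺ ds ds′ {e} m = subst (e ∈_) (sym (map-++ edgeOf ds ds′)) ([ ∈-++⁺ˡ , ∈-++⁺ʳ (map edgeOf ds) ]′ m)

reverseWalk : List Dart → List Dart
reverseWalk ds = reverse (map flip ds)

reverseWalk-Walk : ∀ {a} ds {b} → Walk a ds b → Walk b (reverseWalk ds) a
reverseWalk-Walk []       refl       = refl
reverseWalk-Walk (d ∷ ds) (refl , w) =
  subst (λ ds′ → Walk _ ds′ (from d)) (sym (unfold-reverse (flip d) (map flip ds)))
    (Walk-++ (reverseWalk ds) (reverseWalk-Walk ds w) (flip-walk d))
  where
  flip-walk : ∀ d → Walk (to d) (flip d ∷ []) (from d)
  flip-walk (fwd e) = refl , refl
  flip-walk (bwd e) = refl , refl

edgeOf-flip : ∀ d → edgeOf (flip d) ≡ edgeOf d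
edgeOf-flip (fwd e) = refl
edgeOf-flip (bwd e) = refl

from-flip : ∀ d → from (flip d) ≡ to d
from-flip (fwd e) = refl
from-flip (bwd e) = refl

reverseWalk-∈⁻ : ∀ ds {d} → d ∈ reverseWalk ds → ∃ λ d′ → d′ ∈ ds × d ≡ flip d′
reverseWalk-∈⁻ ds m with ∈-map⁻ flip (Any.reverse⁻ m)
... | d′ , d′∈ , eq = d′ , d′∈ , eq

reverseWalk-edges⁺ : ∀ ds {e} → e ∈ map edgeOf ds → e ∈ map edgeOf (reverseWalk ds)
reverseWalk-edges⁺ ds m with ∈-map⁻ edgeOf m
... | d , d∈ , refl = subst (_∈ map edgeOf (reverseWalk ds)) (edgeOf-flip d)
                        (∈-map⁺ edgeOf (Any.reverse⁺ (∈-map⁺ flip d∈)))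

reverseWalk-froms : ∀ ds → map from (reverseWalk ds) ≡ reverse (map to ds)
reverseWalk-froms ds = begin
  map from (reverse (map flip ds))  ≡⟨ reverse-map from (map flip ds) ⟩
  reverse (map from (map flip ds))  ≡⟨ cong reverse (sym (map-∘ ds)) ⟩
  reverse (map (from ∘ flip) ds)    ≡⟨ cong reverse (map-cong from-flip ds) ⟩
  reverse (map to ds)               ∎
  where open ≡-Reasoning

-- Rows and vertical paths

row : ℕ → ℕ → ℕ → List Dart
row a j zero    = []
row a j (suc n) = fwd (hor a j) ∷ row (suc a) j n

length-row : ∀ a j n → length (row a j n) ≡ n
length-row a j zero    = refl
length-row a j (suc n) = cong suc (length-row (suc a) j n)

row-walk : ∀ a j n → Walk (node a j) (row a j n) (node (n + a) j)
row-walk a j zero    = refl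
row-walk a j (suc n) = refl , Walk-subst (row (suc a) j n) refl (cong (λ i → node i j) (+-suc n a)) (row-walk (suc a) j n)

row-∈⁻ : ∀ a j n {d} → d ∈ row a j n → ∃ λ i → a ≤ i × i < n + a × d ≡ fwd (hor i j)
row-∈⁻ a j (suc n) (here refl) = a , ≤-refl , s≤s (m≤n+m a n) , refl
row-∈⁻ a j (suc n) (there m) with row-∈⁻ (suc a) j n m
... | i , a<i , i< , eq = i , <⇒≤ a<i , subst (i <_) (+-suc n a) i< , eq

hor-∈-row : ∀ a j n {i} → a ≤ i → i < n + a → hor i j ∈ map edgeOf (row a j n)
hor-∈-row a j zero    a≤i i<a = ⊥-elim (<⇒≱ i<a a≤i)
hor-∈-row a j (suc n) {i} a≤i i< with i ≟ a
... | yes refl = here refl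
... | no  i≢a  = there (hor-∈-row (suc a) j n (≤∧≢⇒< a≤i (i≢a ∘ sym)) (subst (suc i ≤_) (sym (+-suc n a)) i<))

row-nodes : ∀ a j n {v} → v ∈ walkNodes (row a j n) (node (n + a) j) → ∃ λ i → v ≡ node i j × a ≤ i × i ≤ n + a
row-nodes a j n m with walkNodes-∈⁻ (row a j n) (row-walk a j n) m
... | inj₁ refl = a , refl , ≤-refl , m≤n+m a n
... | inj₂ (d , d∈ , refl) with row-∈⁻ a j n d∈
... | i , a≤i , i< , refl = suc i , refl , m≤n⇒m≤1+n a≤i , i<

row-nodes-unique : ∀ a j n → Unique (walkNodes (row a j n) (node (n + a) j))
row-nodes-unique a j zero    = unique-∷ (λ ()) []
row-nodes-unique a j (suc n) = unique-∷ a∉ (subst (λ b → Unique (walkNodes (row (suc a) j n) b)) end (row-nodes-unique (suc a) j n))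
  where
  end : node (n + suc a) j ≡ node (suc n + a) j
  end = cong (λ i → node i j) (+-suc n a)
  a∉ : node a j ∉ walkNodes (row (suc a) j n) (node (suc n + a) j)
  a∉ m with row-nodes (suc a) j n (subst (λ b → node a j ∈ walkNodes (row (suc a) j n) b) (sym end) m)
  ... | i , refl , a<a , _ = 1+n≰n a<a

parity-suc : ∀ j → (j % 2 ≡ 0 × suc j % 2 ≡ 1) ⊎ (j % 2 ≡ 1 × suc j % 2 ≡ 0)
parity-suc zero          = inj₁ (refl , refl)
parity-suc (suc zero)    = inj₂ (refl , refl)
parity-suc (suc (suc j)) = parity-suc j

m%2≤1 : ∀ m → m % 2 ≤ 1
m%2≤1 m = ≤-pred (m%n<n m 2)

-- A vertical path of the wall uses the columns c and c + 1 (c even), and leaves row j upwards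
-- from column zigzagCol c j, since ver i j is an edge only for i + j even.
zigzagCol : ℕ → ℕ → ℕ
zigzagCol c j = c + j % 2

zigzagCol≤ : ∀ c j → zigzagCol c j ≤ c + 1
zigzagCol≤ c j = +-monoʳ-≤ c (m%2≤1 j)

zigzagCol-suc : ∀ c j → zigzagCol c j ≢ zigzagCol c (suc j)
zigzagCol-suc c j eq with parity-suc j | +-cancelˡ-≡ c (j % 2) (suc j % 2) eq
... | inj₁ (p , q) | e = 0≢1+n (trans (sym p) (trans e q))
... | inj₂ (p , q) | e = 0≢1+n (trans (sym q) (trans (sym e) p))

rungDart : ℕ → EEdge → Dart
rungDart zero    e = bwd e
rungDart (suc _) e = fwd e

-- traversed from zigzagCol c (j ∸ 1) to zigzagCol c j
rung : ℕ → ℕ → Dart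
rung c j = rungDart (j % 2) (hor c j)

rung-ends : ∀ c j → from (rung c (suc j)) ≡ node (zigzagCol c j) (suc j)
                  × to (rung c (suc j)) ≡ node (zigzagCol c (suc j)) (suc j)
rung-ends c j with parity-suc j
... | inj₁ (p , q) rewrite p | q = cong (λ i → node i (suc j)) (sym (+-identityʳ c)) , cong (λ i → node i (suc j)) (+-comm 1 c)
... | inj₂ (p , q) rewrite p | q = cong (λ i → node i (suc j)) (+-comm 1 c) , cong (λ i → node i (suc j)) (sym (+-identityʳ c))

edgeOf-rung : ∀ c j → edgeOf (rung c j) ≡ hor c j
edgeOf-rung c j with j % 2
... | zero  = refl
... | suc _ = refl

-- the part of the vertical path in the columns c, c + 1 between the rows j and n + j
zigzag : ℕ → ℕ → ℕ → List Dart
zigzag c j zero          = []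
zigzag c j (suc zero)    = fwd (ver (zigzagCol c j) j) ∷ []
zigzag c j (suc (suc n)) = fwd (ver (zigzagCol c j) j) ∷ rung c (suc j) ∷ zigzag c (suc j) (suc n)

zigzag-walk : ∀ c j m → Walk (node (zigzagCol c j) j) (zigzag c j (suc m)) (node (zigzagCol c (m + j)) (suc (m + j)))
zigzag-walk c j zero    = refl , refl
zigzag-walk c j (suc m) = refl , sym (proj₁ (rung-ends c j)) ,
  Walk-subst (zigzag c (suc j) (suc m)) (sym (proj₂ (rung-ends c j)))
    (cong₂ (λ a b → node (zigzagCol c a) (suc b)) (+-suc m j) (+-suc m j)) (zigzag-walk c (suc j) m)

zigzag-∈⁻ : ∀ c j n {d} → d ∈ zigzag c j n →
  (∃ λ j′ → j ≤ j′ × j′ < n + j × d ≡ fwd (ver (zigzagCol c j′) j′)) ⊎ (∃ λ j′ → j < j′ × j′ < n + j × d ≡ rung c j′)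
zigzag-∈⁻ c j (suc zero)    (here refl)         = inj₁ (j , ≤-refl , ≤-refl , refl)
zigzag-∈⁻ c j (suc (suc n)) (here refl)         = inj₁ (j , ≤-refl , s≤s (m≤n+m j (suc n)) , refl)
zigzag-∈⁻ c j (suc (suc n)) (there (here refl)) = inj₂ (suc j , ≤-refl , s≤s (s≤s (m≤n+m j n)) , refl)
zigzag-∈⁻ c j (suc (suc n)) (there (there m)) with zigzag-∈⁻ c (suc j) (suc n) m
... | inj₁ (j′ , j< , <n , eq) = inj₁ (j′ , <⇒≤ j< , subst (j′ <_) (+-suc (suc n) j) <n , eq)
... | inj₂ (j′ , j< , <n , eq) = inj₂ (j′ , <-trans (n<1+n j) j< , subst (j′ <_) (+-suc (suc n) j) <n , eq)

ver-∈-zigzag : ∀ c j n {j′} → j ≤ j′ → j′ < n + j → ver (zigzagCol c j′) j′ ∈ map edgeOf (zigzag c j n)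
ver-∈-zigzag c j zero          j≤ <j       = ⊥-elim (<⇒≱ <j j≤)
ver-∈-zigzag c j (suc zero)    j≤ (s≤s ≤j) with ≤-antisym j≤ ≤j
... | refl = here refl
ver-∈-zigzag c j (suc (suc n)) {j′} j≤ <n =
  [ (λ j< → there (there (ver-∈-zigzag c (suc j) (suc n) j< (subst (j′ <_) (sym (+-suc (suc n) j)) <n))))
  , (λ { refl → here refl }) ]′ (m≤n⇒m<n∨m≡n j≤)

rung-∈-zigzag : ∀ c j n {j′} → j < j′ → j′ < n + j → hor c j′ ∈ map edgeOf (zigzag c j n)
rung-∈-zigzag c j zero          j< <j       = ⊥-elim (<⇒≱ <j (<⇒≤ j<))
rung-∈-zigzag c j (suc zero)    j< (s≤s ≤j) = ⊥-elim (<⇒≱ j< ≤j)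
rung-∈-zigzag c j (suc (suc n)) {j′} j< <n =
  [ (λ j<′ → there (there (rung-∈-zigzag c (suc j) (suc n) j<′ (subst (j′ <_) (sym (+-suc (suc n) j)) <n))))
  , (λ { refl → there (here (sym (edgeOf-rung c (suc j)))) }) ]′ (m≤n⇒m<n∨m≡n j<)

InZigzag : ℕ → ℕ → ℕ → ℕ → ℕ → Set
InZigzag c j m i j′ = j ≤ j′ × j′ ≤ suc (m + j) × c ≤ i × i ≤ c + 1 ×
  (j′ ≡ j → i ≡ zigzagCol c j) × (j′ ≡ suc (m + j) → i ≡ zigzagCol c (m + j))

zigzag-nodes : ∀ c j m {v} → v ∈ walkNodes (zigzag c j (suc m)) (node (zigzagCol c (m + j)) (suc (m + j))) →
  NodeWith v (InZigzag c j m)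
zigzag-nodes c j m mv with walkNodes-∈⁻ (zigzag c j (suc m)) (zigzag-walk c j m) mv
... | inj₁ refl = _ , j , refl , ≤-refl , m≤n⇒m≤1+n (m≤n+m j m) , m≤m+n c _ , zigzagCol≤ c j ,
                  (λ _ → refl) , (λ eq → ⊥-elim (<⇒≢ (s≤s (m≤n+m j m)) eq))
... | inj₂ (d , d∈ , refl) with zigzag-∈⁻ c j (suc m) d∈
... | inj₁ (j′ , j≤ , <m , refl) = _ , suc j′ , refl , m≤n⇒m≤1+n j≤ , <m , m≤m+n c _ , zigzagCol≤ c j′ ,
      (λ eq → ⊥-elim (<⇒≢ (s≤s j≤) (sym eq))) , (λ eq → cong (zigzagCol c) (suc-injective eq))
... | inj₂ (zero , () , _ , refl)
... | inj₂ (suc j′ , j< , <m , refl) = _ , suc j′ , proj₂ (rung-ends c j′) , <⇒≤ j< , <⇒≤ <m , m≤m+n c _ , zigzagCol≤ c (suc j′) ,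
      (λ eq → ⊥-elim (<⇒≢ j< (sym eq))) , (λ eq → ⊥-elim (<⇒≢ <m eq))

zigzag-nodes-unique : ∀ c j m → Unique (walkNodes (zigzag c j (suc m)) (node (zigzagCol c (m + j)) (suc (m + j))))
zigzag-nodes-unique c j zero    = unique-∷ (λ { (here eq) → 1+n≢n (sym (proj₂ (node-injective eq))) }) (unique-∷ (λ ()) [])
zigzag-nodes-unique c j (suc m) = unique-∷ first∉ (unique-∷ second∉ rest-unique)
  where
  end : node (zigzagCol c (m + suc j)) (suc (m + suc j)) ≡ node (zigzagCol c (suc m + j)) (suc (suc m + j))
  end = cong₂ (λ a b → node (zigzagCol c a) (suc b)) (+-suc m j) (+-suc m j)
  rest : List V
  rest = walkNodes (zigzag c (suc j) (suc m)) (node (zigzagCol c (suc m + j)) (suc (suc m + j)))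
  rest-unique : Unique rest
  rest-unique = subst (λ b → Unique (walkNodes (zigzag c (suc j) (suc m)) b)) end (zigzag-nodes-unique c (suc j) m)
  in-rest : ∀ {v} → v ∈ rest → NodeWith v (InZigzag c (suc j) m)
  in-rest {v} mv = zigzag-nodes c (suc j) m (subst (λ b → v ∈ walkNodes (zigzag c (suc j) (suc m)) b) (sym end) mv)
  second∉ : from (rung c (suc j)) ∉ rest
  second∉ mv with in-rest mv
  ... | i , j′ , eq , _ , _ , _ , _ , at-start , _ with node-injective (trans (sym (proj₁ (rung-ends c j))) eq)
  ... | refl , refl = zigzagCol-suc c j (at-start refl)
  first∉ : node (zigzagCol c j) j ∉ from (rung c (suc j)) ∷ rest
  first∉ (here eq)  = 1+n≢n (sym (proj₂ (node-injective (trans eq (proj₁ (rung-ends c j))))))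
  first∉ (there mv) with in-rest mv
  ... | i , j′ , eq , j< , _ = <⇒≢ j< (proj₂ (node-injective eq))

-- Subwalls and layers

≡ᵇ-refl : ∀ n → (n ≡ᵇ n) ≡ true
≡ᵇ-refl zero    = refl
≡ᵇ-refl (suc n) = ≡ᵇ-refl n

≢⇒≡ᵇ-false : ∀ m n → m ≢ n → (m ≡ᵇ n) ≡ false
≢⇒≡ᵇ-false zero    zero    m≢n = ⊥-elim (m≢n refl)
≢⇒≡ᵇ-false zero    (suc n) _   = refl
≢⇒≡ᵇ-false (suc m) zero    _   = refl
≢⇒≡ᵇ-false (suc m) (suc n) m≢n = ≢⇒≡ᵇ-false m n (m≢n ∘ cong suc)

module _ (r t : ℕ) where

  lftC-bottom : lftC r t t ≡ 2 * t + t % 2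
  lftC-bottom rewrite ≡ᵇ-refl t = refl

  rgtC-bottom : rgtC r t t ≡ 2 * hiB r t + t % 2
  rgtC-bottom rewrite ≡ᵇ-refl t = refl

  lftC-top : hiB r t ≢ t → lftC r t (hiB r t) ≡ 2 * t + suc t % 2
  lftC-top H≢t rewrite ≢⇒≡ᵇ-false (hiB r t) t H≢t | ≡ᵇ-refl (hiB r t) = refl

  rgtC-top : hiB r t ≢ t → rgtC r t (hiB r t) ≡ 2 * hiB r t + suc t % 2
  rgtC-top H≢t rewrite ≢⇒≡ᵇ-false (hiB r t) t H≢t | ≡ᵇ-refl (hiB r t) = refl

  2t≤lftC : ∀ j → 2 * t ≤ lftC r t j
  2t≤lftC j with j ≡ᵇ t | j ≡ᵇ hiB r t
  ... | true  | _     = m≤m+n _ _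
  ... | false | true  = m≤m+n _ _
  ... | false | false = ≤-refl

  lftC≤2t+1 : ∀ j → lftC r t j ≤ 2 * t + 1
  lftC≤2t+1 j with j ≡ᵇ t | j ≡ᵇ hiB r t
  ... | true  | _     = +-monoʳ-≤ (2 * t) (m%2≤1 t)
  ... | false | true  = +-monoʳ-≤ (2 * t) (m%2≤1 (suc t))
  ... | false | false = m≤m+n _ _

  2H≤rgtC : ∀ j → 2 * hiB r t ≤ rgtC r t j
  2H≤rgtC j with j ≡ᵇ t | j ≡ᵇ hiB r t
  ... | true  | _     = m≤m+n _ _
  ... | false | true  = m≤m+n _ _
  ... | false | false = m≤m+n _ _

  rgtC≤2H+1 : ∀ j → rgtC r t j ≤ 2 * hiB r t + 1
  rgtC≤2H+1 j with j ≡ᵇ t | j ≡ᵇ hiB r t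
  ... | true  | _     = +-monoʳ-≤ (2 * hiB r t) (m%2≤1 t)
  ... | false | true  = +-monoʳ-≤ (2 * hiB r t) (m%2≤1 (suc t))
  ... | false | false = ≤-refl

[d+d+x]%2≡x%2 : ∀ d x → (d + d + x) % 2 ≡ x % 2
[d+d+x]%2≡x%2 zero    x = refl
[d+d+x]%2≡x%2 (suc d) x rewrite +-suc d d = [d+d+x]%2≡x%2 d x

2*-double : ∀ a → 2 * a ≡ a + a
2*-double a = cong (a +_) (+-identityʳ a)

zigzag-ver-even : ∀ a j → (zigzagCol (2 * a) j + j) % 2 ≡ 0
zigzag-ver-even a j rewrite 2*-double a | +-assoc (a + a) (j % 2) j = trans ([d+d+x]%2≡x%2 a (j % 2 + j)) (even j)
  where
  even : ∀ j → (j % 2 + j) % 2 ≡ 0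
  even zero          = refl
  even (suc zero)    = refl
  even (suc (suc j)) rewrite +-suc (j % 2) (suc j) | +-suc (j % 2) j = even j

ver-col-parity : ∀ a b j → (2 * a + b + j) % 2 ≡ 0 → b ≤ 1 → b ≡ j % 2
ver-col-parity a b j even b≤1 rewrite 2*-double a | +-assoc (a + a) b j | [d+d+x]%2≡x%2 a (b + j) = go b j even b≤1
  where
  go : ∀ b j → (b + j) % 2 ≡ 0 → b ≤ 1 → b ≡ j % 2
  go zero          zero          _  _        = refl
  go zero          (suc zero)    () _
  go zero          (suc (suc j)) e  l        = go zero j e l
  go (suc zero)    zero          () _
  go (suc zero)    (suc zero)    _  _        = refl
  go (suc zero)    (suc (suc j)) e  l        = go (suc zero) j e l
  go (suc (suc b)) j             _  (s≤s ())

InBox : ℕ → ℕ → ℕ → ℕ → Set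
InBox t H i j = t ≤ j × j ≤ H × 2 * t ≤ i × i ≤ 2 * H + 1

SideCol : ℕ → ℕ → ℕ → Set
SideCol t H i = i ≡ 2 * t ⊎ i ≡ 2 * t + 1 ⊎ i ≡ 2 * H ⊎ i ≡ 2 * H + 1

OnFrame : ℕ → ℕ → ℕ → ℕ → Set
OnFrame t H i j = InBox t H i j × (j ≡ t ⊎ j ≡ H ⊎ SideCol t H i)

2t+1≤2H+1 : ∀ {t H} → t ≤ H → 2 * t + 1 ≤ 2 * H + 1
2t+1≤2H+1 t≤H = +-monoˡ-≤ 1 (*-monoʳ-≤ 2 t≤H)

2*-<-mono : ∀ {a b} → a < b → 2 * a + 1 < 2 * b
2*-<-mono {a} {b} a<b = subst (_≤ 2 * b) (sym (trans (cong suc (+-comm (2 * a) 1)) (sym (*-suc 2 a)))) (*-monoʳ-≤ 2 a<b)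

SideCol-bounds : ∀ {t H i} → t ≤ H → SideCol t H i → 2 * t ≤ i × i ≤ 2 * H + 1
SideCol-bounds t≤H (inj₁ refl)               = ≤-refl , ≤-trans (m≤m+n _ 1) (2t+1≤2H+1 t≤H)
SideCol-bounds t≤H (inj₂ (inj₁ refl))        = m≤m+n _ 1 , 2t+1≤2H+1 t≤H
SideCol-bounds t≤H (inj₂ (inj₂ (inj₁ refl))) = *-monoʳ-≤ 2 t≤H , m≤m+n _ 1
SideCol-bounds t≤H (inj₂ (inj₂ (inj₂ refl))) = ≤-trans (*-monoʳ-≤ 2 t≤H) (m≤m+n _ 1) , ≤-refl

OnFrame-side : ∀ {t H i j} → t ≤ j → j ≤ H → t ≤ H → SideCol t H i → OnFrame t H i j
OnFrame-side t≤j j≤H t≤H side = (t≤j , j≤H , SideCol-bounds t≤H side) , inj₂ (inj₂ side)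

module _ (r t : ℕ) (t≤H : t ≤ hiB r t) where

  private
    H = hiB r t

  horizontal-OnFrame : ∀ {i j} → (j ≡ t ⊎ j ≡ H) → lftC r t j ≤ i → i ≤ rgtC r t j → OnFrame t H i j
  horizontal-OnFrame (inj₁ refl) l≤ ≤r = (≤-refl , t≤H , ≤-trans (2t≤lftC r t t) l≤ , ≤-trans ≤r (rgtC≤2H+1 r t t)) , inj₁ refl
  horizontal-OnFrame (inj₂ refl) l≤ ≤r = (t≤H , ≤-refl , ≤-trans (2t≤lftC r t H) l≤ , ≤-trans ≤r (rgtC≤2H+1 r t H)) , inj₂ (inj₁ refl)

  layerE-ends-OnFrame : ∀ e {i j} → LayerE r t e → IsEndOf e (node i j) → OnFrame t H i j
  layerE-ends-OnFrame (hor a b) (inj₁ (row , l≤ , <r)) (inj₁ refl) = horizontal-OnFrame row l≤ (≤-trans (n≤1+n a) <r)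
  layerE-ends-OnFrame (hor a b) (inj₁ (row , l≤ , <r)) (inj₂ refl) = horizontal-OnFrame row (≤-trans l≤ (n≤1+n a)) <r
  layerE-ends-OnFrame (hor a b) (inj₂ (t< , <H , inj₁ refl)) (inj₁ refl) = OnFrame-side (<⇒≤ t<) (<⇒≤ <H) t≤H (inj₁ refl)
  layerE-ends-OnFrame (hor a b) (inj₂ (t< , <H , inj₁ refl)) (inj₂ refl) =
    OnFrame-side (<⇒≤ t<) (<⇒≤ <H) t≤H (inj₂ (inj₁ (+-comm 1 (2 * t))))
  layerE-ends-OnFrame (hor a b) (inj₂ (t< , <H , inj₂ refl)) (inj₁ refl) = OnFrame-side (<⇒≤ t<) (<⇒≤ <H) t≤H (inj₂ (inj₂ (inj₁ refl)))
  layerE-ends-OnFrame (hor a b) (inj₂ (t< , <H , inj₂ refl)) (inj₂ refl) =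
    OnFrame-side (<⇒≤ t<) (<⇒≤ <H) t≤H (inj₂ (inj₂ (inj₂ (+-comm 1 (2 * H)))))
  layerE-ends-OnFrame (ver a b) (t≤ , <H , side) (inj₁ refl) = OnFrame-side t≤ (≤-trans (n≤1+n b) <H) t≤H side
  layerE-ends-OnFrame (ver a b) (t≤ , <H , side) (inj₂ refl) = OnFrame-side (m≤n⇒m≤1+n t≤) <H t≤H side

  layer-node-OnFrame : ∀ s {i j} → vtx (layer r s t) (node i j) → OnFrame t H i j
  layer-node-OnFrame s (e , _ , in-layer , m) = layerE-ends-OnFrame e in-layer (node-∈-chain⁻ s e m)

compassE-ends-InBox : ∀ r t e {i j} → CompassE r t e → IsEndOf e (node i j) → InBox t (hiB r t) i j
compassE-ends-InBox r t (hor a b) (t≤ , ≤H , l≤ , <r) (inj₁ refl) = t≤ , ≤H , ≤-trans (2t≤lftC r t b) l≤ , ≤-trans (n≤1+n a) (≤-trans <r (rgtC≤2H+1 r t b))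
compassE-ends-InBox r t (hor a b) (t≤ , ≤H , l≤ , <r) (inj₂ refl) = t≤ , ≤H , ≤-trans (2t≤lftC r t b) (≤-trans l≤ (n≤1+n a)) , ≤-trans <r (rgtC≤2H+1 r t b)
compassE-ends-InBox r t (ver a b) (t≤ , <H , 2t≤ , ≤2H+1) (inj₁ refl) = t≤ , ≤-trans (n≤1+n b) <H , 2t≤ , ≤2H+1
compassE-ends-InBox r t (ver a b) (t≤ , <H , 2t≤ , ≤2H+1) (inj₂ refl) = m≤n⇒m≤1+n t≤ , <H , 2t≤ , ≤2H+1

compass-node-InBox : ∀ r s t {i j} → vtx (compass r s t) (node i j) → InBox t (hiB r t) i j
compass-node-InBox r s t (e , _ , in-compass , m) = compassE-ends-InBox r t e in-compass (node-∈-chain⁻ s e m)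

inner-box∩frame-empty : ∀ {t t′ H H′ i j} → t < t′ → H′ < H → InBox t′ H′ i j → ¬ OnFrame t H i j
inner-box∩frame-empty t< <H (t′≤ , ≤H′ , 2t′≤ , ≤2H′+1) (_ , side) with side
... | inj₁ refl                      = <⇒≱ t< t′≤
... | inj₂ (inj₁ refl)               = <⇒≱ <H ≤H′
... | inj₂ (inj₂ (inj₁ refl))        = <⇒≱ (≤-trans (m≤m+n _ 1) (2*-<-mono t<)) 2t′≤
... | inj₂ (inj₂ (inj₂ (inj₁ refl))) = <⇒≱ (2*-<-mono t<) 2t′≤
... | inj₂ (inj₂ (inj₂ (inj₂ (inj₁ refl)))) = <⇒≱ (2*-<-mono <H) ≤2H′+1
... | inj₂ (inj₂ (inj₂ (inj₂ (inj₂ refl)))) = <⇒≱ (2*-<-mono <H) (≤-trans (m≤m+n _ 1) ≤2H′+1)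

OnFrame-between-sides : ∀ {t H i j} → 2 * t + 1 < i → i < 2 * H → OnFrame t H i j → j ≡ t ⊎ j ≡ H
OnFrame-between-sides _ _ (_ , inj₁ j≡t)        = inj₁ j≡t
OnFrame-between-sides _ _ (_ , inj₂ (inj₁ j≡H)) = inj₂ j≡H
OnFrame-between-sides 2t+1<i i<2H (_ , inj₂ (inj₂ side)) with side
... | inj₁ refl               = ⊥-elim (<⇒≱ 2t+1<i (m≤m+n _ 1))
... | inj₂ (inj₁ refl)        = ⊥-elim (<-irrefl refl 2t+1<i)
... | inj₂ (inj₂ (inj₁ refl)) = ⊥-elim (<-irrefl refl i<2H)
... | inj₂ (inj₂ (inj₂ refl)) = ⊥-elim (<⇒≱ i<2H (m≤m+n _ 1))

OnFrame-between-rows : ∀ {t H i j} → t < j → j < H → OnFrame t H i j → SideCol t H i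
OnFrame-between-rows t<j _   (_ , inj₁ refl)        = ⊥-elim (<-irrefl refl t<j)
OnFrame-between-rows _   j<H (_ , inj₂ (inj₁ refl)) = ⊥-elim (<-irrefl refl j<H)
OnFrame-between-rows _   _   (_ , inj₂ (inj₂ side)) = side

-- t′ ≤ hiB r t′ says that the subwall S_t′ is not empty.
module _ (r : ℕ) {t t′ : ℕ} (t<t′ : t < t′) (t′≤H′ : t′ ≤ hiB r t′) where

  hiB-inner< : hiB r t′ < hiB r t
  hiB-inner< = ∸-monoʳ-< t<t′ (≤-trans t′≤H′ (m∸n≤m (r ∸ 1) t′))

  t≤hiB-outer : t ≤ hiB r t
  t≤hiB-outer = <⇒≤ (≤-trans (s≤s (≤-trans (<⇒≤ t<t′) t′≤H′)) hiB-inner<)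

  inner-box∩outer-frame-empty : ∀ {i j} → InBox t′ (hiB r t′) i j → ¬ OnFrame t (hiB r t) i j
  inner-box∩outer-frame-empty = inner-box∩frame-empty t<t′ hiB-inner<

  compassE-mono : ∀ e → CompassE r t′ e → CompassE r t e
  compassE-mono (hor a b) (t′≤ , ≤H′ , l≤ , <r) =
    ≤-trans (<⇒≤ t<t′) t′≤ , ≤-trans ≤H′ (<⇒≤ hiB-inner<) ,
    ≤-trans (lftC≤2t+1 r t b) (≤-trans (<⇒≤ (2*-<-mono t<t′)) (≤-trans (2t≤lftC r t′ b) l≤)) ,
    ≤-trans <r (≤-trans (rgtC≤2H+1 r t′ b) (≤-trans (<⇒≤ (2*-<-mono hiB-inner<)) (2H≤rgtC r t b)))
  compassE-mono (ver a b) (t′≤ , <H′ , 2t′≤ , ≤2H′+1) =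
    ≤-trans (<⇒≤ t<t′) t′≤ , ≤-trans <H′ (<⇒≤ hiB-inner<) ,
    ≤-trans (*-monoʳ-≤ 2 (<⇒≤ t<t′)) 2t′≤ , ≤-trans ≤2H′+1 (+-monoˡ-≤ 1 (*-monoʳ-≤ 2 (<⇒≤ hiB-inner<)))

  no-edge-inside-and-on-frame : ∀ e → (∀ {i j} → IsEndOf e (node i j) → InBox t′ (hiB r t′) i j) →
    ¬ (∀ {i j} → IsEndOf e (node i j) → OnFrame t (hiB r t) i j)
  no-edge-inside-and-on-frame (hor a b) inside on-frame = inner-box∩outer-frame-empty (inside (inj₁ refl)) (on-frame (inj₁ refl))
  no-edge-inside-and-on-frame (ver a b) inside on-frame = inner-box∩outer-frame-empty (inside (inj₁ refl)) (on-frame (inj₁ refl))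

  inner-compass⊆OpenDisk : ∀ s v → vtx (compass r s t′) v → OpenDisk r s t v
  inner-compass⊆OpenDisk s v (e , valid , in-compass , m) = (e , valid , compassE-mono e in-compass , m) , off-layer v m
    where
    off-layer : ∀ v → v ∈ chain s e → ¬ vtx (layer r s t) v
    off-layer (node i j) m on-layer =
      inner-box∩outer-frame-empty (compass-node-InBox r s t′ (e , valid , in-compass , m))
        (layer-node-OnFrame r t t≤hiB-outer s on-layer)
    off-layer (mid _ _) m (e′ , _ , in-layer , m′) with mid-∈-chain⁻ s e m | mid-∈-chain⁻ s e′ m′
    ... | refl , _ | refl , _ =
      no-edge-inside-and-on-frame e (compassE-ends-InBox r t′ e in-compass) (layerE-ends-OnFrame r t t≤hiB-outer e in-layer)

  layers-disjoint : ∀ s v → vtx (layer r s t) v → vtx (layer r s t′) v → ⊥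
  layers-disjoint s (node i j) on-t on-t′ =
    inner-box∩outer-frame-empty (proj₁ (layer-node-OnFrame r t′ t′≤H′ s on-t′)) (layer-node-OnFrame r t t≤hiB-outer s on-t)
  layers-disjoint s (mid _ _) (e , _ , in-t , m) (e′ , _ , in-t′ , m′) with mid-∈-chain⁻ s e m | mid-∈-chain⁻ s e′ m′
  ... | refl , _ | refl , _ =
    no-edge-inside-and-on-frame e (proj₁ ∘ layerE-ends-OnFrame r t′ t′≤H′ e in-t′) (layerE-ends-OnFrame r t t≤hiB-outer e in-t)

ElemVertex-intro : ∀ R {i j} → i ≤ 2 * R + 1 → j ≤ R → (i ≡ 2 * R + 1 → 0 < j) → (i ≡ 0 → j < R) → ElemVertex (suc R) i j
ElemVertex-intro R {i} {j} i≤ j≤ right-corner left-corner =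
  subst (i <_) (sym 2[1+R]) (s≤s (subst (i ≤_) (+-comm (2 * R) 1) i≤)) , s≤s j≤ ,
  (λ (i≡ , j≡0) → <⇒≢ (right-corner (trans i≡ (trans (cong (_∸ 1) 2[1+R]) (+-comm 1 (2 * R))))) (sym j≡0)) ,
  (λ (i≡0 , j≡) → <⇒≢ (left-corner i≡0) j≡)
  where
  2[1+R] : 2 * suc R ≡ suc (suc (2 * R))
  2[1+R] = *-suc 2 R

FrameNode : ℕ → ℕ → ℕ → ℕ → Set
FrameNode t H i j = (j ≡ t × 2 * t + t % 2 ≤ i × i ≤ 2 * H + t % 2)
  ⊎ (j ≡ H × 2 * t + suc t % 2 ≤ i × i ≤ 2 * H + suc t % 2)
  ⊎ (t < j × j < H × SideCol t H i)

module _ {t H : ℕ} (t+1<H : suc t < H) where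

  private
    t≤H : t ≤ H
    t≤H = ≤-trans (n≤1+n t) (<⇒≤ t+1<H)

  FrameNode-col≤ : ∀ {i j} → FrameNode t H i j → i ≤ 2 * H + 1
  FrameNode-col≤ (inj₁ (_ , _ , ≤c))          = ≤-trans ≤c (+-monoʳ-≤ (2 * H) (m%2≤1 t))
  FrameNode-col≤ (inj₂ (inj₁ (_ , _ , ≤c)))   = ≤-trans ≤c (+-monoʳ-≤ (2 * H) (m%2≤1 (suc t)))
  FrameNode-col≤ (inj₂ (inj₂ (_ , _ , side))) = proj₂ (SideCol-bounds t≤H side)

  FrameNode-row≤ : ∀ {i j} → FrameNode t H i j → j ≤ H
  FrameNode-row≤ (inj₁ (refl , _))           = t≤H
  FrameNode-row≤ (inj₂ (inj₁ (refl , _)))    = ≤-refl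
  FrameNode-row≤ (inj₂ (inj₂ (_ , j<H , _))) = <⇒≤ j<H

-- The corner adjustments of the bottom and top rows keep the frame off the two deleted corners of the wall.
FrameNode-right-corner : ∀ {t H i j} → suc t < H → FrameNode t H i j → i ≡ 2 * (H + t) + 1 → 0 < j
FrameNode-right-corner t+1<H (inj₂ (inj₁ (refl , _))) _ = ≤-trans (s≤s z≤n) (<⇒≤ t+1<H)
FrameNode-right-corner _     (inj₂ (inj₂ (t<j , _))) _  = ≤-trans (s≤s z≤n) t<j
FrameNode-right-corner {suc t} _ (inj₁ (refl , _)) _    = s≤s z≤n
FrameNode-right-corner {zero} {H} _ (inj₁ (refl , _ , ≤c)) refl =
  ⊥-elim (<⇒≱ (subst (λ x → 2 * H + 0 < 2 * x + 1) (sym (+-identityʳ H)) (+-monoʳ-< (2 * H) (s≤s z≤n))) ≤c)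

FrameNode-left-corner : ∀ {t H i j} → suc t < H → FrameNode t H i j → i ≡ 0 → j < H + t
FrameNode-left-corner t+1<H (inj₁ (refl , _)) _        = m<n+m _ (≤-trans (s≤s z≤n) t+1<H)
FrameNode-left-corner _ (inj₂ (inj₂ (_ , j<H , _))) _  = ≤-trans j<H (m≤m+n _ _)
FrameNode-left-corner {zero}  _ (inj₂ (inj₁ (_ , 1≤i , _))) refl = ⊥-elim (<⇒≱ (s≤s z≤n) 1≤i)
FrameNode-left-corner {suc t} _ (inj₂ (inj₁ (_ , () , _))) refl

FrameNode-ElemVertex : ∀ {t H i j} → suc t < H → FrameNode t H i j → ElemVertex (suc (H + t)) i j
FrameNode-ElemVertex {t} {H} t+1<H frame =
  ElemVertex-intro (H + t) (≤-trans (FrameNode-col≤ t+1<H frame) (+-monoˡ-≤ 1 (*-monoʳ-≤ 2 (m≤m+n H t))))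
    (≤-trans (FrameNode-row≤ t+1<H frame) (m≤m+n H t))
    (FrameNode-right-corner t+1<H frame) (FrameNode-left-corner t+1<H frame)

-- The layer t of the wall of height r = 2 t + 2 d + 3: the frame of the subwall with rows t … H, H = t + 2 d + 2.
module FrameCycle (t d : ℕ) where

  n H r p q : ℕ
  n = suc (suc (d + d))
  H = n + t
  r = suc (H + t)
  p = t % 2
  q = suc t % 2

  hiB≡H : hiB r t ≡ H
  hiB≡H = m+n∸n≡m H t

  t+1<H : suc t < H
  t+1<H = s≤s (s≤s (m≤n+m t (d + d)))

  t<H : t < H
  t<H = <-trans (n<1+n t) t+1<H

  hiB≢t : hiB r t ≢ t
  hiB≢t eq = <⇒≢ t<H (sym (trans (sym hiB≡H) eq))

  top-parity : (suc (d + d) + t) % 2 ≡ q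
  top-parity = trans (cong (_% 2) (sym (+-suc (d + d) t))) ([d+d+x]%2≡x%2 d (suc t))

  2n+ : ∀ x → 2 * n + (2 * t + x) ≡ 2 * H + x
  2n+ x = trans (sym (+-assoc (2 * n) (2 * t) x)) (cong (_+ x) (sym (*-distribˡ-+ 2 n t)))

  bottomRow rightSide leftSide topRow lower upper frame : List Dart
  bottomRow = row (2 * t + p) t (2 * n)
  rightSide = zigzag (2 * H) t n
  leftSide  = zigzag (2 * t) t n
  topRow    = row (2 * t + q) H (2 * n)
  lower     = bottomRow ++ rightSide
  upper     = leftSide ++ topRow
  frame     = lower ++ reverseWalk upper

  corner opposite : V
  corner   = node (2 * t + p) t
  opposite = node (2 * H + q) H

  rightSide-end : node (zigzagCol (2 * H) (suc (d + d) + t)) H ≡ opposite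
  rightSide-end = cong (λ x → node (2 * H + x) H) top-parity

  leftSide-end : node (zigzagCol (2 * t) (suc (d + d) + t)) H ≡ node (2 * t + q) H
  leftSide-end = cong (λ x → node (2 * t + x) H) top-parity

  lower-walk : Walk corner lower opposite
  lower-walk = Walk-++ bottomRow (Walk-subst bottomRow refl (cong (λ i → node i t) (2n+ p)) (row-walk (2 * t + p) t (2 * n)))
                 (Walk-subst rightSide refl rightSide-end (zigzag-walk (2 * H) t (suc (d + d))))

  upper-walk : Walk corner upper opposite
  upper-walk = Walk-++ leftSide (Walk-subst leftSide refl leftSide-end (zigzag-walk (2 * t) t (suc (d + d))))
                 (Walk-subst topRow refl (cong (λ i → node i H) (2n+ q)) (row-walk (2 * t + q) H (2 * n)))

  frame-walk : Walk corner frame corner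
  frame-walk = Walk-++ lower lower-walk (reverseWalk-Walk upper upper-walk)

  bottomRow-froms : ∀ {v} → v ∈ map from bottomRow → NodeWith v (λ i j → j ≡ t × i < 2 * H + p)
  bottomRow-froms m with ∈-map⁻ from m
  ... | d′ , d∈ , refl with row-∈⁻ (2 * t + p) t (2 * n) d∈
  ... | i , _ , i< , refl = i , t , refl , refl , subst (i <_) (2n+ p) i<

  side-froms : ∀ c {v} → v ∈ map from (zigzag c t n) → NodeWith v (λ i j → j < H × c ≤ i × i ≤ c + 1)
  side-froms c m with ∈-map⁻ from m
  ... | d′ , d∈ , refl with zigzag-∈⁻ c t n d∈
  ... | inj₁ (j′ , _ , j′< , refl)       = _ , j′ , refl , j′< , m≤m+n c _ , zigzagCol≤ c j′
  ... | inj₂ (zero , () , _ , refl)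
  ... | inj₂ (suc j′ , _ , j′< , refl) = _ , suc j′ , proj₁ (rung-ends c j′) , j′< , m≤m+n c _ , zigzagCol≤ c j′

  side-tos : ∀ c {v} → v ∈ map to (zigzag c t n) → NodeWith v (λ i j → t < j × c ≤ i × i ≤ c + 1)
  side-tos c m with ∈-map⁻ to m
  ... | d′ , d∈ , refl with zigzag-∈⁻ c t n d∈
  ... | inj₁ (j′ , t≤ , _ , refl)       = _ , suc j′ , refl , s≤s t≤ , m≤m+n c _ , zigzagCol≤ c j′
  ... | inj₂ (zero , () , _ , refl)
  ... | inj₂ (suc j′ , t< , _ , refl) = _ , suc j′ , proj₂ (rung-ends c j′) , t< , m≤m+n c _ , zigzagCol≤ c (suc j′)

  topRow-tos : ∀ {v} → v ∈ map to topRow → NodeWith v (λ i j → j ≡ H)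
  topRow-tos m with ∈-map⁻ to m
  ... | d′ , d∈ , refl with row-∈⁻ (2 * t + q) H (2 * n) d∈
  ... | i , _ , _ , refl = suc i , H , refl , refl

  same-node : ∀ {v i j i′ j′} → v ≡ node i j → v ≡ node i′ j′ → i ≡ i′ × j ≡ j′
  same-node refl = node-injective

  lower-nodes-unique : Unique (walkNodes lower opposite)
  lower-nodes-unique = subst Unique (sym (walkNodes-++ bottomRow rightSide opposite))
    (Unique.++⁺ (unique-++⁻ˡ (map from bottomRow) (row-nodes-unique (2 * t + p) t (2 * n)))
                (subst (λ b → Unique (walkNodes rightSide b)) rightSide-end (zigzag-nodes-unique (2 * H) t (suc (d + d))))
                disjoint)
    where
    disjoint : ∀ {v} → ¬ (v ∈ map from bottomRow × v ∈ walkNodes rightSide opposite)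
    disjoint {v} (m₁ , m₂) with bottomRow-froms m₁
                          | zigzag-nodes (2 * H) t (suc (d + d)) (subst (λ b → v ∈ walkNodes rightSide b) (sym rightSide-end) m₂)
    ... | i , j , eq , refl , i< | i′ , j′ , eq′ , (_ , _ , _ , _ , at-start , _) with same-node eq eq′
    ... | refl , refl = <⇒≢ i< (at-start refl)

  upper-nodes-unique : Unique (walkNodes upper opposite)
  upper-nodes-unique = subst Unique (sym (walkNodes-++ leftSide topRow opposite))
    (Unique.++⁺ (unique-++⁻ˡ (map from leftSide) (zigzag-nodes-unique (2 * t) t (suc (d + d))))
                (subst (λ b → Unique (walkNodes topRow b)) (cong (λ i → node i H) (2n+ q)) (row-nodes-unique (2 * t + q) H (2 * n)))
                disjoint)
    where
    disjoint : ∀ {v} → ¬ (v ∈ map from leftSide × v ∈ walkNodes topRow opposite)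
    disjoint {v} (m₁ , m₂) with side-froms (2 * t) m₁
                          | row-nodes (2 * t + q) H (2 * n) (subst (λ b → v ∈ walkNodes topRow b) (sym (cong (λ i → node i H) (2n+ q))) m₂)
    ... | i , j , eq , j<H , _ | i′ , eq′ , _ with same-node eq eq′
    ... | refl , refl = <-irrefl refl j<H

  lower-froms∩upper-tos-empty : ∀ {v} → v ∈ map from lower → v ∉ map to upper
  lower-froms∩upper-tos-empty {v} m₁ m₂
    with ∈-++⁻ (map from bottomRow) (subst (v ∈_) (map-++ from bottomRow rightSide) m₁)
       | ∈-++⁻ (map to leftSide) (subst (v ∈_) (map-++ to leftSide topRow) m₂)
  ... | inj₁ a | inj₁ b with bottomRow-froms a | side-tos (2 * t) b
  ...   | _ , _ , eq , refl , _ | _ , _ , eq′ , t< , _ with same-node eq eq′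
  ...   | _ , refl = <-irrefl refl t<
  lower-froms∩upper-tos-empty m₁ m₂ | inj₁ a | inj₂ b with bottomRow-froms a | topRow-tos b
  ...   | _ , _ , eq , refl , _ | _ , _ , eq′ , refl with same-node eq eq′
  ...   | _ , t≡H = <⇒≢ t<H t≡H
  lower-froms∩upper-tos-empty m₁ m₂ | inj₂ a | inj₁ b with side-froms (2 * H) a | side-tos (2 * t) b
  ...   | _ , _ , eq , _ , 2H≤ , _ | _ , _ , eq′ , _ , _ , ≤2t+1 with same-node eq eq′
  ...   | refl , _ = <⇒≱ (2*-<-mono t<H) (≤-trans 2H≤ ≤2t+1)
  lower-froms∩upper-tos-empty m₁ m₂ | inj₂ a | inj₂ b with side-froms (2 * H) a | topRow-tos b
  ...   | _ , _ , eq , j<H , _ | _ , _ , eq′ , refl with same-node eq eq′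
  ...   | _ , refl = <-irrefl refl j<H

  frame-froms-unique : Unique (map from frame)
  frame-froms-unique = subst Unique (sym (map-++ from lower (reverseWalk upper)))
    (Unique.++⁺ (unique-++⁻ˡ (map from lower) lower-nodes-unique)
                (subst Unique (sym (reverseWalk-froms upper)) (unique-reverse upper-tos-unique))
                (λ (m₁ , m₂) → lower-froms∩upper-tos-empty m₁ (Any.reverse⁻ (subst (_ ∈_) (reverseWalk-froms upper) m₂))))
    where
    upper-tos-unique : Unique (map to upper)
    upper-tos-unique = AllPairs.tail (subst Unique (walkNodes-start upper upper-walk) upper-nodes-unique)

  FrameEdge : EEdge → Set
  FrameEdge e = ValidEdge r e × LayerE r t e

  on-frame : ∀ {i j} → FrameNode t H i j → ElemVertex r i j
  on-frame = FrameNode-ElemVertex t+1<H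

  2t≤2H : 2 * t ≤ 2 * H
  2t≤2H = *-monoʳ-≤ 2 (<⇒≤ t<H)

  bottom-edge : ∀ {i} → 2 * t + p ≤ i → i < 2 * H + p → FrameEdge (hor i t)
  bottom-edge {i} l≤ <r =
    (on-frame (inj₁ (refl , l≤ , <⇒≤ <r)) , on-frame (inj₁ (refl , m≤n⇒m≤1+n l≤ , <r))) ,
    inj₁ (inj₁ refl , subst (_≤ i) (sym (lftC-bottom r t)) l≤ ,
          subst (suc i ≤_) (sym (trans (rgtC-bottom r t) (cong (λ x → 2 * x + p) hiB≡H))) <r)

  top-edge : ∀ {i} → 2 * t + q ≤ i → i < 2 * H + q → FrameEdge (hor i H)
  top-edge {i} l≤ <r =
    (on-frame (inj₂ (inj₁ (refl , l≤ , <⇒≤ <r))) , on-frame (inj₂ (inj₁ (refl , m≤n⇒m≤1+n l≤ , <r)))) ,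
    subst (λ j → LayerE r t (hor i j)) hiB≡H
      (inj₁ (inj₂ refl , subst (_≤ i) (sym (lftC-top r t hiB≢t)) l≤ ,
             subst (suc i ≤_) (sym (trans (rgtC-top r t hiB≢t) (cong (λ x → 2 * x + q) hiB≡H))) <r))

  rung-edge : ∀ {c j} → (c ≡ 2 * t ⊎ c ≡ 2 * H) → t < j → j < H → FrameEdge (hor c j)
  rung-edge {c} {j} side t<j j<H = (on-frame (inj₂ (inj₂ (t<j , j<H , left-end side))) ,
                                    on-frame (inj₂ (inj₂ (t<j , j<H , right-end side)))) , in-layer side
    where
    left-end : (c ≡ 2 * t ⊎ c ≡ 2 * H) → SideCol t H c
    left-end (inj₁ refl) = inj₁ refl
    left-end (inj₂ refl) = inj₂ (inj₂ (inj₁ refl))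
    right-end : (c ≡ 2 * t ⊎ c ≡ 2 * H) → SideCol t H (suc c)
    right-end (inj₁ refl) = inj₂ (inj₁ (+-comm 1 (2 * t)))
    right-end (inj₂ refl) = inj₂ (inj₂ (inj₂ (+-comm 1 (2 * H))))
    in-layer : (c ≡ 2 * t ⊎ c ≡ 2 * H) → LayerE r t (hor c j)
    in-layer side = inj₂ (subst (λ x → t < j × j < x × (c ≡ 2 * t ⊎ c ≡ 2 * x)) (sym hiB≡H) (t<j , j<H , side))

  side-edge : ∀ c j → (c ≡ 2 * t ⊎ c ≡ 2 * H) → t ≤ j → j < H → FrameEdge (ver (zigzagCol c j) j)
  side-edge c j side t≤j j<H = (on-frame lower-end , on-frame upper-end , even side) ,
    subst (λ x → t ≤ j × suc j ≤ x × SideCol t x (zigzagCol c j)) (sym hiB≡H) (t≤j , j<H , col)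
    where
    even : (c ≡ 2 * t ⊎ c ≡ 2 * H) → (zigzagCol c j + j) % 2 ≡ 0
    even (inj₁ refl) = zigzag-ver-even t j
    even (inj₂ refl) = zigzag-ver-even H j
    col-of : (c ≡ 2 * t ⊎ c ≡ 2 * H) → ((j % 2 ≡ 0 × suc j % 2 ≡ 1) ⊎ (j % 2 ≡ 1 × suc j % 2 ≡ 0)) → SideCol t H (zigzagCol c j)
    col-of (inj₁ refl) (inj₁ (j%2≡0 , _)) = inj₁ (trans (cong (2 * t +_) j%2≡0) (+-identityʳ _))
    col-of (inj₁ refl) (inj₂ (j%2≡1 , _)) = inj₂ (inj₁ (cong (2 * t +_) j%2≡1))
    col-of (inj₂ refl) (inj₁ (j%2≡0 , _)) = inj₂ (inj₂ (inj₁ (trans (cong (2 * H +_) j%2≡0) (+-identityʳ _))))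
    col-of (inj₂ refl) (inj₂ (j%2≡1 , _)) = inj₂ (inj₂ (inj₂ (cong (2 * H +_) j%2≡1)))
    col : SideCol t H (zigzagCol c j)
    col = col-of side (parity-suc j)
    corner-col : (c ≡ 2 * t ⊎ c ≡ 2 * H) → ∀ x → 2 * t + x ≤ c + x × c + x ≤ 2 * H + x
    corner-col (inj₁ refl) x = ≤-refl , +-monoˡ-≤ x 2t≤2H
    corner-col (inj₂ refl) x = +-monoˡ-≤ x 2t≤2H , ≤-refl
    lower-end : FrameNode t H (zigzagCol c j) j
    lower-end with j ≟ t
    ... | yes j≡t = inj₁ (j≡t , subst (λ k → 2 * t + k % 2 ≤ zigzagCol c j × zigzagCol c j ≤ 2 * H + k % 2) j≡t
                                  (corner-col side (j % 2)))
    ... | no  j≢t = inj₂ (inj₂ (≤∧≢⇒< t≤j (j≢t ∘ sym) , j<H , col))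
    upper-end : FrameNode t H (zigzagCol c j) (suc j)
    upper-end with suc j ≟ H
    ... | yes j+1≡H = inj₂ (inj₁ (j+1≡H , subst (λ x → 2 * t + x ≤ zigzagCol c j × zigzagCol c j ≤ 2 * H + x)
                                            (trans (cong (_% 2) (suc-injective j+1≡H)) top-parity) (corner-col side (j % 2))))
    ... | no  j+1≢H = inj₂ (inj₂ (s≤s t≤j , ≤∧≢⇒< j<H j+1≢H , col))

  side-dart : ∀ c → (c ≡ 2 * t ⊎ c ≡ 2 * H) → ∀ {d′} → d′ ∈ zigzag c t n → FrameEdge (edgeOf d′)
  side-dart c side d∈ with zigzag-∈⁻ c t n d∈
  ... | inj₁ (j , t≤j , j<H , refl)     = side-edge c j side t≤j j<H
  ... | inj₂ (zero , () , _ , refl)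
  ... | inj₂ (suc j , t<j , j<H , refl) = subst FrameEdge (sym (edgeOf-rung c (suc j))) (rung-edge side t<j j<H)

  bottomRow-dart : ∀ {d′} → d′ ∈ bottomRow → FrameEdge (edgeOf d′)
  bottomRow-dart d∈ with row-∈⁻ (2 * t + p) t (2 * n) d∈
  ... | i , l≤ , <r , refl = bottom-edge l≤ (subst (i <_) (2n+ p) <r)

  topRow-dart : ∀ {d′} → d′ ∈ topRow → FrameEdge (edgeOf d′)
  topRow-dart d∈ with row-∈⁻ (2 * t + q) H (2 * n) d∈
  ... | i , l≤ , <r , refl = top-edge l≤ (subst (i <_) (2n+ q) <r)

  frame-sound : ∀ {d′} → d′ ∈ frame → FrameEdge (edgeOf d′)
  frame-sound d∈ with ∈-++⁻ lower d∈
  ... | inj₁ d∈lower with ∈-++⁻ bottomRow d∈lower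
  ...   | inj₁ d∈′ = bottomRow-dart d∈′
  ...   | inj₂ d∈′ = side-dart (2 * H) (inj₂ refl) d∈′
  frame-sound d∈ | inj₂ d∈rev with reverseWalk-∈⁻ upper d∈rev
  ... | d″ , d∈upper , refl with ∈-++⁻ leftSide d∈upper
  ...   | inj₁ d∈′ = subst FrameEdge (sym (edgeOf-flip d″)) (side-dart (2 * t) (inj₁ refl) d∈′)
  ...   | inj₂ d∈′ = subst FrameEdge (sym (edgeOf-flip d″)) (topRow-dart d∈′)

  in-lower : ∀ ds ds′ {e} → lower ≡ ds ++ ds′ → e ∈ map edgeOf ds ⊎ e ∈ map edgeOf ds′ → e ∈ map edgeOf frame
  in-lower ds ds′ {e} eq m = subst (e ∈_) (sym (map-++ edgeOf lower (reverseWalk upper)))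
    (∈-++⁺ˡ (subst (λ L → e ∈ map edgeOf L) (sym eq) (edgeOf-++⁺ ds ds′ m)))

  in-upper : ∀ ds ds′ {e} → upper ≡ ds ++ ds′ → e ∈ map edgeOf ds ⊎ e ∈ map edgeOf ds′ → e ∈ map edgeOf frame
  in-upper ds ds′ {e} eq m = subst (e ∈_) (sym (map-++ edgeOf lower (reverseWalk upper)))
    (∈-++⁺ʳ (map edgeOf lower) (reverseWalk-edges⁺ upper (subst (λ L → e ∈ map edgeOf L) (sym eq) (edgeOf-++⁺ ds ds′ m))))

  side-vertical : ∀ a b j → (a ≡ t ⊎ a ≡ H) → b ≤ 1 → (2 * a + b + j) % 2 ≡ 0 → t ≤ j → j < H →
    ver (2 * a + b) j ∈ map edgeOf frame
  side-vertical a b j side b≤1 even t≤j j<H =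
    subst (λ x → ver x j ∈ map edgeOf frame) (cong (2 * a +_) (sym (ver-col-parity a b j even b≤1))) (on side)
    where
    on : (a ≡ t ⊎ a ≡ H) → ver (zigzagCol (2 * a) j) j ∈ map edgeOf frame
    on (inj₁ refl) = in-upper leftSide topRow refl (inj₁ (ver-∈-zigzag (2 * t) t n t≤j j<H))
    on (inj₂ refl) = in-lower bottomRow rightSide refl (inj₂ (ver-∈-zigzag (2 * H) t n t≤j j<H))

  frame-complete : ∀ e → ValidEdge r e → LayerE r t e → e ∈ map edgeOf frame
  frame-complete (hor i j) _ (inj₁ (inj₁ refl , l≤ , <r)) =
    in-lower bottomRow rightSide refl (inj₁ (hor-∈-row (2 * t + p) t (2 * n) (subst (_≤ i) (lftC-bottom r t) l≤)
      (subst (i <_) (sym (2n+ p)) (subst (suc i ≤_) (trans (rgtC-bottom r t) (cong (λ x → 2 * x + p) hiB≡H)) <r))))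
  frame-complete (hor i j) _ (inj₁ (inj₂ refl , l≤ , <r)) = subst (λ x → hor i x ∈ map edgeOf frame) (sym hiB≡H)
    (in-upper leftSide topRow refl (inj₂ (hor-∈-row (2 * t + q) H (2 * n) (subst (_≤ i) (lftC-top r t hiB≢t) l≤)
      (subst (i <_) (sym (2n+ q)) (subst (suc i ≤_) (trans (rgtC-top r t hiB≢t) (cong (λ x → 2 * x + q) hiB≡H)) <r)))))
  frame-complete (hor i j) _ (inj₂ (t<j , j<H , inj₁ refl)) =
    in-upper leftSide topRow refl (inj₁ (rung-∈-zigzag (2 * t) t n t<j (subst (j <_) hiB≡H j<H)))
  frame-complete (hor i j) _ (inj₂ (t<j , j<H , inj₂ refl)) = subst (λ x → hor (2 * x) j ∈ map edgeOf frame) (sym hiB≡H)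
    (in-lower bottomRow rightSide refl (inj₂ (rung-∈-zigzag (2 * H) t n t<j (subst (j <_) hiB≡H j<H))))
  frame-complete (ver i j) (_ , _ , even) (t≤j , j<H , inj₁ refl) =
    subst (λ x → ver x j ∈ map edgeOf frame) (+-identityʳ (2 * t))
      (side-vertical t 0 j (inj₁ refl) z≤n (subst (λ x → (x + j) % 2 ≡ 0) (sym (+-identityʳ (2 * t))) even) t≤j (subst (suc j ≤_) hiB≡H j<H))
  frame-complete (ver i j) (_ , _ , even) (t≤j , j<H , inj₂ (inj₁ refl)) =
    side-vertical t 1 j (inj₁ refl) ≤-refl even t≤j (subst (suc j ≤_) hiB≡H j<H)
  frame-complete (ver i j) (_ , _ , even) (t≤j , j<H , inj₂ (inj₂ (inj₁ refl))) =
    subst (λ x → ver x j ∈ map edgeOf frame) (trans (+-identityʳ (2 * H)) (cong (2 *_) (sym hiB≡H)))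
      (side-vertical H 0 j (inj₂ refl) z≤n (subst (λ x → (x + j) % 2 ≡ 0) (trans (cong (2 *_) hiB≡H) (sym (+-identityʳ (2 * H)))) even)
        t≤j (subst (suc j ≤_) hiB≡H j<H))
  frame-complete (ver i j) (_ , _ , even) (t≤j , j<H , inj₂ (inj₂ (inj₂ refl))) =
    subst (λ x → ver (2 * x + 1) j ∈ map edgeOf frame) (sym hiB≡H)
      (side-vertical H 1 j (inj₂ refl) ≤-refl (subst (λ x → (2 * x + 1 + j) % 2 ≡ 0) hiB≡H even) t≤j (subst (suc j ≤_) hiB≡H j<H))

  frame-traces : Traces r (LayerE r t) frame
  frame-traces = frame-sound , frame-complete

  frame-length : 3 ≤ length frame
  frame-length = begin
    3                   ≤⟨ ≤-trans (n≤1+n 3) (*-monoʳ-≤ 2 (s≤s (s≤s z≤n))) ⟩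
    2 * n               ≡⟨ length-row (2 * t + p) t (2 * n) ⟨
    length bottomRow    ≤⟨ length-++-≤ bottomRow rightSide ⟩
    length lower        ≤⟨ length-++-≤ lower (reverseWalk upper) ⟩
    length frame        ∎
    where open ≤-Reasoning

layer-IsCycleGraph : ∀ r s t d → r ≡ suc (suc (suc (d + d)) + t + t) → IsCycleGraph (layer r s t)
layer-IsCycleGraph .(suc (suc (suc (d + d)) + t + t)) s t d refl =
  closedWalk-IsCycleGraph r s (LayerE r t) frame frame-walk frame-froms-unique frame-length frame-traces
  where open FrameCycle t d

-- Rails

IsRail : ℕ → (EEdge → ℕ) → ℕ → List V → Set
IsRail r s X P = IsPathIn r s P × (∀ t → t < suc X → IsPathGraph (layer r s t ∩G pathSubgraph P)) × All (λ v → ¬ OpenDisk r s X v) P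

CrossesAt : ℕ → (EEdge → ℕ) → ℕ → List Dart → V → EEdge → Set
CrossesAt r s t ds b e = ValidEdge r e × LayerE r t e × e ∈ map edgeOf ds ×
  (∀ {v} → v ∈ walkNodes ds b → vtx (layer r s t) v → IsEndOf e v)

TouchesAt : ℕ → (EEdge → ℕ) → ℕ → List Dart → V → V → Set
TouchesAt r s X ds b n = n ∈ walkNodes ds b × vtx (layer r s X) n ×
  (∀ {i j} → node i j ∈ walkNodes ds b → InBox X (hiB r X) i j → node i j ≡ n)

walkPath-IsRail : ∀ r s X {a} ds {b} → Walk a ds b → 1 ≤ length ds → Unique (walkNodes ds b) →
  (∀ {d} → d ∈ ds → ValidEdge r (edgeOf d)) → X ≤ hiB r X →
  (∀ t → t < X → ∃ (CrossesAt r s t ds b)) → ∃ (TouchesAt r s X ds b) → IsRail r s X (walkPath s ds b)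
walkPath-IsRail r s X ds@(d₀ ∷ _) {b} w@(refl , _) 1≤ un valid X≤H crosses (n , n∈ , n-on-X , only-n) =
  walkPath-IsPathIn r s ds w 1≤ un valid , meets , tabulate outside
  where
  a-node : IsNode (from d₀)
  a-node = from-IsNode d₀
  on-X-is-n : ∀ {v} → v ∈ walkNodes ds b → vtx (layer r s X) v → v ≡ n
  on-X-is-n m on-X with walkNodes-IsNode ds w a-node m
  ... | i , j , refl = only-n m (proj₁ (layer-node-OnFrame r X X≤H s on-X))
  meets : ∀ t → t < suc X → IsPathGraph (layer r s t ∩G pathSubgraph (walkPath s ds b))
  meets t (s≤s t≤X) with m≤n⇒m<n∨m≡n t≤X
  ... | inj₁ t<X with crosses t t<X
  ...   | e , valid-e , in-t , e∈ , only-e = spanned∩walkPath-edge r s (LayerE r t) ds w e valid-e in-t e∈ only-e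
  meets t (s≤s t≤X) | inj₂ refl = spanned∩walkPath-node r s (LayerE r X) ds w n n∈ n-on-X on-X-is-n
  outside : ∀ {v} → v ∈ walkPath s ds b → ¬ OpenDisk r s X v
  outside m (in-compass , off-X) with walkPath-∈-classify s ds w m
  ... | inj₁ q with walkNodes-IsNode ds w a-node q
  ...   | i , j , refl = off-X (subst (vtx (layer r s X)) (sym (only-n q (compass-node-InBox r s X in-compass))) n-on-X)
  -- an interior vertex in the compass puts both ends of its edge into the box, where only n lies
  outside m (in-compass , off-X) | inj₂ (e , k , refl , e∈ , _) with in-compass
  ... | e′ , _ , e′-in-compass , m′ with mid-∈-chain⁻ s e′ m′ | ∈-map⁻ edgeOf e∈
  ...   | refl , _ | d , d∈ , refl = from≢to d (trans (end-is-n (proj₁ (dart-ends-∈-walkNodes ds w d∈)) (from-∈-chain s d))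
                                                      (sym (end-is-n (proj₂ (dart-ends-∈-walkNodes ds w d∈)) (to-∈-chain s d))))
    where
    end-is-n : ∀ {v} → v ∈ walkNodes ds b → v ∈ chain s (edgeOf d) → v ≡ n
    end-is-n mv mc with walkNodes-IsNode ds w a-node mv
    ... | i , j , refl = only-n mv (compassE-ends-InBox r X (edgeOf d) e′-in-compass (node-∈-chain⁻ s (edgeOf d) mc))

walkPaths-disjoint : ∀ s {a₁} ds₁ {b₁ a₂} ds₂ {b₂} → Walk a₁ ds₁ b₁ → IsNode a₁ → Walk a₂ ds₂ b₂ → IsNode a₂ →
  (∀ {v} → v ∈ walkNodes ds₁ b₁ → v ∉ walkNodes ds₂ b₂) → ∀ v → v ∈ walkPath s ds₁ b₁ → v ∉ walkPath s ds₂ b₂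
walkPaths-disjoint s ds₁ ds₂ w₁ a₁-node w₂ a₂-node disjoint v m₁ m₂
  with walkPath-∈-classify s ds₁ w₁ m₁ | walkPath-∈-classify s ds₂ w₂ m₂
... | inj₁ p | inj₁ q = disjoint p q
... | inj₁ p | inj₂ (_ , _ , eq , _) = IsNode⇒≢mid (walkNodes-IsNode ds₁ w₁ a₁-node p) eq
... | inj₂ (_ , _ , eq , _) | inj₁ q = IsNode⇒≢mid (walkNodes-IsNode ds₂ w₂ a₂-node q) eq
... | inj₂ (e , _ , refl , e∈ , _) | inj₂ (_ , _ , eq , e∈′ , _) with mid-injectiveˡ eq
... | refl = disjoint (src-∈-walkNodes ds₁ w₁ e∈) (src-∈-walkNodes ds₂ w₂ e∈′)

HX-halves : ∀ u κ → suc (suc (suc (u + u)) + suc (κ + κ)) ≡ (2 + u + κ) + (2 + u + κ) + 0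
HX-halves = solve-∀

X+HX-halves : ∀ u κ → suc (u + u) + suc (suc (suc (u + u)) + suc (κ + κ)) ≡ (2 + u + u + κ) + (2 + u + u + κ) + 1
X+HX-halves = solve-∀

layer-height : ∀ m t κ → suc (m + t + suc (m + t + suc (κ + κ))) ≡ suc (suc (suc ((m + κ) + (m + κ))) + t + t)
layer-height = solve-∀

between-c-c+1 : ∀ {c i} → c ≤ i → i ≤ c + 1 → i ≡ c ⊎ i ≡ suc c
between-c-c+1 {c} {i} c≤i i≤ with m≤n⇒m<n∨m≡n c≤i
... | inj₂ eq = inj₁ (sym eq)
... | inj₁ lt = inj₂ (≤-antisym (subst (i ≤_) (+-comm c 1) i≤) lt)

-- The wall of height r = 2 x + k, where x = X + 1 with X = 2 u + 2 and k = 2 κ + 1.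
-- Its layer X (the x-th layer) spans the rows X … HX, where HX = X + k + 1.
module Dimensions (u κ : ℕ) where

  X k HX r : ℕ
  X = suc (suc (u + u))
  k = suc (κ + κ)
  HX = suc (X + k)
  r = suc (X + HX)

  hiB≡ : ∀ t → t ≤ X → hiB r t ≡ (X ∸ t) + HX
  hiB≡ t t≤X = +-∸-comm HX t≤X

  HX≤hiB : ∀ t → t ≤ X → HX ≤ hiB r t
  HX≤hiB t t≤X = subst (HX ≤_) (sym (hiB≡ t t≤X)) (m≤n+m HX (X ∸ t))

  HX<hiB : ∀ t → t < X → HX < hiB r t
  HX<hiB t t<X = subst (HX <_) (sym (hiB≡ t (<⇒≤ t<X))) (+-monoˡ-< HX (m<n⇒0<n∸m t<X))

  hiB-X : hiB r X ≡ HX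
  hiB-X = trans (hiB≡ X ≤-refl) (cong (_+ HX) (n∸n≡0 X))

  hiB≤ : ∀ t → hiB r t ≤ X + HX
  hiB≤ t = m∸n≤m (X + HX) t

  X<HX : X < HX
  X<HX = s≤s (m≤m+n X k)

  X≤hiB-X : X ≤ hiB r X
  X≤hiB-X = subst (X ≤_) (sym hiB-X) (<⇒≤ X<HX)

  t≤hiB : ∀ t → t ≤ X → t ≤ hiB r t
  t≤hiB t t≤X = ≤-trans t≤X (≤-trans (<⇒≤ X<HX) (HX≤hiB t t≤X))

  X-even : X % 2 ≡ 0
  X-even = trans (cong (_% 2) (+-comm 2 (u + u))) ([d+d+x]%2≡x%2 u 2)

  X+1-odd : suc X % 2 ≡ 1
  X+1-odd = trans (cong (_% 2) (+-comm 3 (u + u))) ([d+d+x]%2≡x%2 u 3)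

  interior-ElemVertex : ∀ {i j} → i ≤ 2 * (X + HX) → j < X + HX → ElemVertex r i j
  interior-ElemVertex i≤ j< =
    ElemVertex-intro (X + HX) (≤-trans i≤ (m≤m+n _ 1)) (<⇒≤ j<) (λ eq → ⊥-elim (<⇒≱ (subst (2 * (X + HX) <_) (sym eq) (m<m+n _ (s≤s z≤n))) i≤)) (λ _ → j<)

  2HX≤ : 2 * HX ≤ 2 * (X + HX)
  2HX≤ = *-monoʳ-≤ 2 (m≤n+m HX X)

  +1<⇒< : ∀ {a b} → a + 1 < b → suc a ≤ b
  +1<⇒< {a} a+1<b = ≤-trans (≤-reflexive (+-comm 1 a)) (<⇒≤ a+1<b)

  top-of-W : 2 * X + (2 * HX + 1) ≡ 2 * (X + HX) + 1
  top-of-W = trans (sym (+-assoc (2 * X) (2 * HX) 1)) (cong (_+ 1) (sym (*-distribˡ-+ 2 X HX)))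

  HX-even : HX % 2 ≡ 0
  HX-even = trans (cong (_% 2) (HX-halves u κ)) ([d+d+x]%2≡x%2 (2 + u + κ) 0)

  X+HX-odd : (suc (u + u) + HX) % 2 ≡ 1
  X+HX-odd = trans (cong (_% 2) (X+HX-halves u κ)) ([d+d+x]%2≡x%2 (2 + u + u + κ) 1)


module Wall (s : EEdge → ℕ) (u κ : ℕ) where

  open Dimensions u κ

  module BottomRail (a : ℕ) (a≤k : a ≤ k) where

    c : ℕ
    c = 2 * (X + a)

    darts : List Dart
    darts = bwd (hor c 0) ∷ zigzag c 0 X

    end : V
    end = node (suc c) X

    X+a<HX : X + a < HX
    X+a<HX = s≤s (+-monoʳ-≤ X a≤k)

    c+1≤ : c + 1 ≤ 2 * (X + HX)
    c+1≤ = ≤-trans (<⇒≤ (2*-<-mono X+a<HX)) 2HX≤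

    zigzag-end : node (zigzagCol c (suc (u + u) + 0)) (suc (suc (u + u) + 0)) ≡ end
    zigzag-end = cong₂ node (trans (cong (λ x → c + x % 2) (+-identityʳ (suc (u + u)))) (trans (cong (c +_) X+1-odd) (+-comm c 1)))
                            (cong suc (+-identityʳ (suc (u + u))))

    walk : Walk (node (suc c) 0) darts end
    walk = refl , Walk-subst (zigzag c 0 X) (cong (λ i → node i 0) (+-identityʳ c)) zigzag-end (zigzag-walk c 0 (suc (u + u)))

    Region : ℕ → ℕ → Set
    Region i j = j ≤ X × c ≤ i × i ≤ c + 1 × (j ≡ X → i ≡ suc c)

    in-zigzag : ∀ {v} → v ∈ walkNodes (zigzag c 0 X) end → NodeWith v (InZigzag c 0 (suc (u + u)))
    in-zigzag {v} m = zigzag-nodes c 0 (suc (u + u)) (subst (λ b → v ∈ walkNodes (zigzag c 0 X) b) (sym zigzag-end) m)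

    nodes : ∀ {v} → v ∈ walkNodes darts end → NodeWith v Region
    nodes (here refl) = _ , 0 , refl , z≤n , n≤1+n _ , ≤-reflexive (+-comm 1 c) , λ ()
    nodes (there m) with in-zigzag m
    ... | i , j , refl , _ , j≤ , c≤i , i≤ , _ , at-end =
      i , j , refl , subst (j ≤_) (cong suc (+-identityʳ _)) j≤ , c≤i , i≤ ,
      λ j≡X → trans (at-end (trans j≡X (cong suc (sym (+-identityʳ _))))) (proj₁ (node-injective zigzag-end))

    nodes-unique : Unique (walkNodes darts end)
    nodes-unique = unique-∷ start∉ (subst (λ b → Unique (walkNodes (zigzag c 0 X) b)) zigzag-end (zigzag-nodes-unique c 0 (suc (u + u))))
      where
      start∉ : node (suc c) 0 ∉ walkNodes (zigzag c 0 X) end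
      start∉ m with in-zigzag m
      ... | i , j , eq , _ , _ , _ , _ , at-start , _ with node-injective eq
      ... | refl , refl = 1+n≢n (trans (at-start refl) (+-identityʳ c))

    on-path : ∀ {i j} → i ≤ c + 1 → j ≤ X → ElemVertex r i j
    on-path i≤ j≤X = interior-ElemVertex (≤-trans i≤ c+1≤) (≤-trans (s≤s j≤X) (m<m+n X (s≤s z≤n)))

    crossing-valid : ∀ j → j ≤ X → ValidEdge r (hor c j)
    crossing-valid j j≤X = on-path (m≤m+n c 1) j≤X , on-path (≤-reflexive (+-comm 1 c)) j≤X

    valid : ∀ {d} → d ∈ darts → ValidEdge r (edgeOf d)
    valid (here refl) = crossing-valid 0 z≤n
    valid (there d∈) with zigzag-∈⁻ c 0 X d∈
    ... | inj₁ (j , _ , j< , refl) = on-path (zigzagCol≤ c j) (<⇒≤ j<′) , on-path (zigzagCol≤ c j) j<′ , zigzag-ver-even (X + a) j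
      where j<′ = subst (j <_) (+-identityʳ X) j<
    ... | inj₂ (zero , () , _ , refl)
    ... | inj₂ (suc j , _ , j< , refl) =
      subst (ValidEdge r) (sym (edgeOf-rung c (suc j))) (crossing-valid (suc j) (<⇒≤ (subst (suc j <_) (+-identityʳ X) j<)))

    crosses : ∀ t → t < X → ∃ (CrossesAt r s t darts end)
    crosses t t<X = hor c t , crossing-valid t (<⇒≤ t<X) , in-layer , ∈-darts t t<X , only-crossing
      where
      t<X+a : t < X + a
      t<X+a = ≤-trans t<X (m≤m+n X a)
      in-layer : LayerE r t (hor c t)
      in-layer = inj₁ (inj₁ refl , ≤-trans (lftC≤2t+1 r t t) (<⇒≤ (2*-<-mono t<X+a)) ,
                       ≤-trans (+1<⇒< (2*-<-mono X+a<HX)) (≤-trans (*-monoʳ-≤ 2 (HX≤hiB t (<⇒≤ t<X))) (2H≤rgtC r t t)))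
      ∈-darts : ∀ t → t < X → hor c t ∈ map edgeOf darts
      ∈-darts zero    _   = here refl
      ∈-darts (suc t) t<X = there (rung-∈-zigzag c 0 X (s≤s z≤n) (subst (suc t <_) (sym (+-identityʳ X)) t<X))
      only-crossing : ∀ {v} → v ∈ walkNodes darts end → vtx (layer r s t) v → IsEndOf (hor c t) v
      only-crossing m on-t with nodes m
      ... | i , j , refl , j≤X , c≤i , i≤ , _
          with OnFrame-between-sides (≤-trans (2*-<-mono t<X+a) c≤i)
                 (≤-trans (s≤s i≤) (≤-trans (2*-<-mono X+a<HX) (*-monoʳ-≤ 2 (HX≤hiB t (<⇒≤ t<X)))))
                 (layer-node-OnFrame r t (t≤hiB t (<⇒≤ t<X)) s on-t)
      ... | inj₂ refl = ⊥-elim (<⇒≱ (≤-trans (s≤s j≤X) (≤-trans X<HX (HX≤hiB t (<⇒≤ t<X)))) ≤-refl)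
      ... | inj₁ refl with between-c-c+1 c≤i i≤
      ...   | inj₁ refl = inj₁ refl
      ...   | inj₂ refl = inj₂ refl

    touches : ∃ (TouchesAt r s X darts end)
    touches = end , end-∈-walkNodes darts , on-X , only-end
      where
      on-X : vtx (layer r s X) end
      on-X = hor c X , crossing-valid X ≤-refl ,
             inj₁ (inj₁ refl , subst (_≤ c) (sym (trans (lftC-bottom r X) (trans (cong (2 * X +_) X-even) (+-identityʳ _))))
                                  (*-monoʳ-≤ 2 (m≤m+n X a)) ,
                   ≤-trans (+1<⇒< (2*-<-mono X+a<HX)) (≤-trans (≤-reflexive (cong (2 *_) (sym hiB-X))) (2H≤rgtC r X X))) ,
             tgt-∈-chain s (hor c X)
      only-end : ∀ {i j} → node i j ∈ walkNodes darts end → InBox X (hiB r X) i j → node i j ≡ end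
      only-end m (X≤j , _) with nodes m
      ... | i , j , eq , j≤X , _ , _ , at-end with node-injective eq
      ... | refl , refl = cong₂ node (at-end (≤-antisym j≤X X≤j)) (≤-antisym j≤X X≤j)

    rail : IsRail r s X (walkPath s darts end)
    rail = walkPath-IsRail r s X darts walk (s≤s z≤n) nodes-unique valid X≤hiB-X crosses touches

  module LeftRail (a : ℕ) (a≤k : a ≤ k) where

    ρ : ℕ
    ρ = X + a

    darts : List Dart
    darts = row 0 ρ (2 * X)

    end : V
    end = node (2 * X) ρ

    ρ<HX : ρ < HX
    ρ<HX = s≤s (+-monoʳ-≤ X a≤k)

    end≡ : node (2 * X + 0) ρ ≡ end
    end≡ = cong (λ i → node i ρ) (+-identityʳ (2 * X))

    walk : Walk (node 0 ρ) darts end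
    walk = Walk-subst darts refl end≡ (row-walk 0 ρ (2 * X))

    Region : ℕ → ℕ → Set
    Region i j = j ≡ ρ × i ≤ 2 * X

    nodes : ∀ {v} → v ∈ walkNodes darts end → NodeWith v Region
    nodes {v} m with row-nodes 0 ρ (2 * X) (subst (λ b → v ∈ walkNodes darts b) (sym end≡) m)
    ... | i , refl , _ , i≤ = i , ρ , refl , refl , subst (i ≤_) (+-identityʳ (2 * X)) i≤

    nodes-unique : Unique (walkNodes darts end)
    nodes-unique = subst (λ b → Unique (walkNodes darts b)) end≡ (row-nodes-unique 0 ρ (2 * X))

    on-path : ∀ {i} → i ≤ 2 * X + 1 → ElemVertex r i ρ
    on-path i≤ = interior-ElemVertex (≤-trans i≤ (≤-trans (<⇒≤ (2*-<-mono X<HX)) 2HX≤)) (≤-trans ρ<HX (m≤n+m HX X))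

    valid : ∀ {d} → d ∈ darts → ValidEdge r (edgeOf d)
    valid d∈ with row-∈⁻ 0 ρ (2 * X) d∈
    ... | i , _ , i< , refl = on-path (≤-trans (<⇒≤ i<′) (m≤m+n _ 1)) , on-path (≤-trans i<′ (m≤m+n _ 1))
      where
      i<′ : i < 2 * X
      i<′ = subst (i <_) (+-identityʳ (2 * X)) i<

    crosses : ∀ t → t < X → ∃ (CrossesAt r s t darts end)
    crosses t t<X = hor (2 * t) ρ , (on-path (≤-trans (m≤m+n _ 1) 2t+1≤) , on-path (≤-trans (≤-reflexive (+-comm 1 (2 * t))) 2t+1≤)) ,
                    inj₂ (t<ρ , ρ<H , inj₁ refl) ,
                    hor-∈-row 0 ρ (2 * X) z≤n (subst (2 * t <_) (sym (+-identityʳ (2 * X))) (≤-trans (s≤s (m≤m+n _ 1)) (2*-<-mono t<X))) ,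
                    only-crossing
      where
      2t+1≤ : 2 * t + 1 ≤ 2 * X + 1
      2t+1≤ = 2t+1≤2H+1 (<⇒≤ t<X)
      t<ρ : t < ρ
      t<ρ = ≤-trans t<X (m≤m+n X a)
      ρ<H : ρ < hiB r t
      ρ<H = ≤-trans ρ<HX (HX≤hiB t (<⇒≤ t<X))
      2X<2H : 2 * X + 1 < 2 * hiB r t
      2X<2H = 2*-<-mono (≤-trans X<HX (HX≤hiB t (<⇒≤ t<X)))
      only-crossing : ∀ {v} → v ∈ walkNodes darts end → vtx (layer r s t) v → IsEndOf (hor (2 * t) ρ) v
      only-crossing m on-t with nodes m
      ... | i , j , refl , refl , i≤ with OnFrame-between-rows t<ρ ρ<H (layer-node-OnFrame r t (t≤hiB t (<⇒≤ t<X)) s on-t)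
      ... | inj₁ refl                      = inj₁ refl
      ... | inj₂ (inj₁ refl)               = inj₂ (cong (λ i → node i ρ) (+-comm (2 * t) 1))
      ... | inj₂ (inj₂ (inj₁ refl))        = ⊥-elim (<⇒≱ (≤-trans (s≤s (m≤m+n _ 1)) 2X<2H) i≤)
      ... | inj₂ (inj₂ (inj₂ refl))        = ⊥-elim (<⇒≱ (≤-trans (s≤s (m≤m+n _ 1)) 2X<2H) (≤-trans (m≤m+n _ 1) i≤))

    touches : ∃ (TouchesAt r s X darts end)
    touches = end , end-∈-walkNodes darts , on-X , only-end
      where
      bottom-of-X : LayerE r X (hor (2 * X) (X + 0))
      bottom-of-X = subst (λ j → LayerE r X (hor (2 * X) j)) (sym (+-identityʳ X))
        (inj₁ (inj₁ refl , subst (_≤ 2 * X) (sym (trans (lftC-bottom r X) (trans (cong (2 * X +_) X-even) (+-identityʳ _)))) ≤-refl ,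
               ≤-trans (+1<⇒< (2*-<-mono X<HX)) (≤-trans (≤-reflexive (cong (2 *_) (sym hiB-X))) (2H≤rgtC r X X))))
      in-layer : LayerE r X (hor (2 * X) ρ)
      in-layer with m≤n⇒m<n∨m≡n (z≤n {a})
      ... | inj₁ 0<a = inj₂ (subst (_< ρ) (+-identityʳ X) (+-monoʳ-< X 0<a) , subst (ρ <_) (sym hiB-X) ρ<HX , inj₁ refl)
      ... | inj₂ 0≡a = subst (λ a′ → LayerE r X (hor (2 * X) (X + a′))) 0≡a bottom-of-X
      on-X : vtx (layer r s X) end
      on-X = hor (2 * X) ρ , (on-path (m≤m+n _ 1) , on-path (≤-reflexive (+-comm 1 (2 * X)))) , in-layer , src-∈-chain s (hor (2 * X) ρ)
      only-end : ∀ {i j} → node i j ∈ walkNodes darts end → InBox X (hiB r X) i j → node i j ≡ end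
      only-end m (_ , _ , 2X≤i , _) with nodes m
      ... | i , j , eq , refl , i≤ with node-injective eq
      ... | refl , refl = cong (λ i → node i ρ) (≤-antisym i≤ 2X≤i)

    rail : IsRail r s X (walkPath s darts end)
    rail = walkPath-IsRail r s X darts walk (s≤s z≤n) nodes-unique valid X≤hiB-X crosses touches

  module RightRail (a : ℕ) (a≤k : a ≤ k) where

    ρ : ℕ
    ρ = suc (X + a)

    darts : List Dart
    darts = row (2 * HX + 1) ρ (2 * X)

    start end : V
    start = node (2 * HX + 1) ρ
    end = node (2 * X + (2 * HX + 1)) ρ

    ρ≤HX : ρ ≤ HX
    ρ≤HX = s≤s (+-monoʳ-≤ X a≤k)

    walk : Walk start darts end
    walk = row-walk (2 * HX + 1) ρ (2 * X)

    Region : ℕ → ℕ → Set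
    Region i j = j ≡ ρ × 2 * HX + 1 ≤ i × i ≤ 2 * X + (2 * HX + 1)

    nodes : ∀ {v} → v ∈ walkNodes darts end → NodeWith v Region
    nodes m with row-nodes (2 * HX + 1) ρ (2 * X) m
    ... | i , refl , l≤ , ≤r = i , ρ , refl , refl , l≤ , ≤r

    nodes-unique : Unique (walkNodes darts end)
    nodes-unique = row-nodes-unique (2 * HX + 1) ρ (2 * X)

    on-row : ∀ {i} → 1 ≤ i → i ≤ 2 * (X + HX) + 1 → ElemVertex r i ρ
    on-row 1≤i i≤ = ElemVertex-intro (X + HX) i≤ (≤-trans ρ≤HX (m≤n+m HX X)) (λ _ → s≤s z≤n) (λ i≡0 → ⊥-elim (<⇒≢ 1≤i (sym i≡0)))

    on-path : ∀ {i} → 2 * HX + 1 ≤ i → i ≤ 2 * X + (2 * HX + 1) → ElemVertex r i ρ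
    on-path {i} l≤ ≤r = on-row (≤-trans (m≤n+m 1 (2 * HX)) l≤) (subst (i ≤_) top-of-W ≤r)

    valid : ∀ {d} → d ∈ darts → ValidEdge r (edgeOf d)
    valid d∈ with row-∈⁻ (2 * HX + 1) ρ (2 * X) d∈
    ... | i , l≤ , i< , refl = on-path l≤ (<⇒≤ i<) , on-path (m≤n⇒m≤1+n l≤) i<

    crosses : ∀ t → t < X → ∃ (CrossesAt r s t darts end)
    crosses t t<X = hor (2 * hiB r t) ρ , (on-path 2HX+1≤ (≤-trans (n≤1+n _) ≤r) , on-path (m≤n⇒m≤1+n 2HX+1≤) ≤r) ,
                    inj₂ (t<ρ , ρ<H , inj₂ refl) , hor-∈-row (2 * HX + 1) ρ (2 * X) 2HX+1≤ ≤r , only-crossing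
      where
      2HX+1≤ : 2 * HX + 1 ≤ 2 * hiB r t
      2HX+1≤ = <⇒≤ (2*-<-mono (HX<hiB t t<X))
      ≤r : suc (2 * hiB r t) ≤ 2 * X + (2 * HX + 1)
      ≤r = subst (suc (2 * hiB r t) ≤_) (sym top-of-W)
             (subst (_≤ 2 * (X + HX) + 1) (+-comm (2 * hiB r t) 1) (+-monoˡ-≤ 1 (*-monoʳ-≤ 2 (hiB≤ t))))
      t<ρ : t < ρ
      t<ρ = ≤-trans t<X (m≤n⇒m≤1+n (m≤m+n X a))
      ρ<H : ρ < hiB r t
      ρ<H = ≤-trans (s≤s ρ≤HX) (HX<hiB t t<X)
      2t+1<2HX : 2 * t + 1 < 2 * HX
      2t+1<2HX = 2*-<-mono (<-trans t<X X<HX)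
      only-crossing : ∀ {v} → v ∈ walkNodes darts end → vtx (layer r s t) v → IsEndOf (hor (2 * hiB r t) ρ) v
      only-crossing m on-t with nodes m
      ... | i , j , refl , refl , l≤ , _ with OnFrame-between-rows t<ρ ρ<H (layer-node-OnFrame r t (t≤hiB t (<⇒≤ t<X)) s on-t)
      ... | inj₁ refl               = ⊥-elim (<⇒≱ (≤-trans (s≤s (m≤m+n _ 1)) 2t+1<2HX) (≤-trans (m≤m+n _ 1) l≤))
      ... | inj₂ (inj₁ refl)        = ⊥-elim (<⇒≱ 2t+1<2HX (≤-trans (m≤m+n _ 1) l≤))
      ... | inj₂ (inj₂ (inj₁ refl)) = inj₁ refl
      ... | inj₂ (inj₂ (inj₂ refl)) = inj₂ (cong (λ i → node i ρ) (+-comm (2 * hiB r t) 1))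

    touches : ∃ (TouchesAt r s X darts end)
    touches = start , start-∈-walkNodes darts walk , on-X , only-start
      where
      in-layer : LayerE r X (hor (2 * HX) ρ)
      in-layer with m≤n⇒m<n∨m≡n ρ≤HX
      ... | inj₁ ρ<HX = inj₂ (s≤s (m≤m+n X a) , subst (ρ <_) (sym hiB-X) ρ<HX , inj₂ (cong (2 *_) (sym hiB-X)))
      ... | inj₂ ρ≡HX = subst (λ j → LayerE r X (hor (2 * HX) j)) (trans hiB-X (sym ρ≡HX))
        (inj₁ (inj₂ refl , ≤-trans (lftC≤2t+1 r X (hiB r X)) (<⇒≤ (2*-<-mono X<HX)) ,
               subst (suc (2 * HX) ≤_) (sym (trans (rgtC-top r X (λ eq → <⇒≢ X<HX (sym (trans (sym hiB-X) eq))))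
                                                   (cong₂ (λ h x → 2 * h + x) hiB-X X+1-odd)))
                 (≤-reflexive (+-comm 1 (2 * HX)))))
      on-X : vtx (layer r s X) start
      on-X = hor (2 * HX) ρ , (on-row (s≤s z≤n) (≤-trans 2HX≤ (m≤m+n _ 1)) ,
                               on-row (s≤s z≤n) (subst (_≤ 2 * (X + HX) + 1) (+-comm (2 * HX) 1) (+-monoˡ-≤ 1 2HX≤))) ,
             in-layer , subst (λ i → node i ρ ∈ chain s (hor (2 * HX) ρ)) (+-comm 1 (2 * HX)) (tgt-∈-chain s (hor (2 * HX) ρ))
      only-start : ∀ {i j} → node i j ∈ walkNodes darts end → InBox X (hiB r X) i j → node i j ≡ start
      only-start m (_ , _ , _ , i≤) with nodes m
      ... | i , j , eq , refl , l≤ , _ with node-injective eq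
      ... | refl , refl = cong (λ i → node i ρ) (≤-antisym (subst (λ h → i ≤ 2 * h + 1) hiB-X i≤) l≤)

    rail : IsRail r s X (walkPath s darts end)
    rail = walkPath-IsRail r s X darts walk (s≤s z≤n) nodes-unique valid X≤hiB-X crosses touches

  module TopRail (a : ℕ) (a≤k : a ≤ k) where

    c : ℕ
    c = 2 * suc (X + a)

    column : List Dart
    column = zigzag c HX X

    darts : List Dart
    darts = column ++ bwd (hor c (X + HX)) ∷ []

    start column-end end : V
    start = node c HX
    column-end = node (suc c) (X + HX)
    end = node c (X + HX)

    X+a+1≤HX : suc (X + a) ≤ HX
    X+a+1≤HX = s≤s (+-monoʳ-≤ X a≤k)

    X<X+a+1 : X < suc (X + a)
    X<X+a+1 = s≤s (m≤m+n X a)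

    column-start : node (zigzagCol c HX) HX ≡ start
    column-start = cong (λ i → node i HX) (trans (cong (c +_) HX-even) (+-identityʳ c))

    column-end≡ : node (zigzagCol c (suc (u + u) + HX)) (X + HX) ≡ column-end
    column-end≡ = cong (λ i → node i (X + HX)) (trans (cong (c +_) X+HX-odd) (+-comm c 1))

    column-walk : Walk start column column-end
    column-walk = Walk-subst column column-start column-end≡ (zigzag-walk c HX (suc (u + u)))

    walk : Walk start darts end
    walk = Walk-++ column column-walk (refl , refl)

    Region : ℕ → ℕ → Set
    Region i j = HX ≤ j × j ≤ X + HX × c ≤ i × i ≤ c + 1 × (j ≡ HX → i ≡ c)

    in-column : ∀ {v} → v ∈ walkNodes column column-end → NodeWith v (InZigzag c HX (suc (u + u)))
    in-column {v} m = zigzag-nodes c HX (suc (u + u)) (subst (λ b → v ∈ walkNodes column b) (sym column-end≡) m)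

    nodes⊆ : ∀ {v} → v ∈ walkNodes darts end → v ∈ walkNodes column column-end ⊎ v ≡ end
    nodes⊆ {v} m with ∈-++⁻ (map from column) (subst (v ∈_) (walkNodes-++ column (bwd (hor c (X + HX)) ∷ []) end) m)
    ... | inj₁ q                 = inj₁ (∈-++⁺ˡ q)
    ... | inj₂ (here refl)       = inj₁ (end-∈-walkNodes column)
    ... | inj₂ (there (here eq)) = inj₂ eq

    nodes : ∀ {v} → v ∈ walkNodes darts end → NodeWith v Region
    nodes m with nodes⊆ m
    ... | inj₂ refl = _ , _ , refl , m≤n+m HX X , ≤-refl , ≤-refl , m≤m+n _ 1 , λ _ → refl
    ... | inj₁ q with in-column q
    ...   | i , j , refl , HX≤ , ≤top , c≤i , i≤ , at-start , _ =
      i , j , refl , HX≤ , ≤top , c≤i , i≤ , λ j≡HX → trans (at-start j≡HX) (proj₁ (node-injective column-start))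

    nodes-unique : Unique (walkNodes darts end)
    nodes-unique = subst Unique (trans (++-assoc (map from column) (column-end ∷ []) (end ∷ []))
                                       (sym (walkNodes-++ column (bwd (hor c (X + HX)) ∷ []) end)))
      (Unique.++⁺ (subst (λ b → Unique (walkNodes column b)) column-end≡ (zigzag-nodes-unique c HX (suc (u + u))))
                  (unique-∷ (λ ()) []) end∉)
      where
      end∉ : ∀ {v} → ¬ (v ∈ walkNodes column column-end × v ∈ end ∷ [])
      end∉ (m , here refl) with in-column m
      ... | i , j , eq , _ , _ , _ , _ , _ , at-end with node-injective eq
      ... | refl , refl = 1+n≢n (sym (trans (at-end refl) (trans (cong (c +_) X+HX-odd) (+-comm c 1))))

    on-path : ∀ {i j} → c ≤ i → i ≤ c + 1 → j ≤ X + HX → ElemVertex r i j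
    on-path {i} c≤i i≤ j≤ = ElemVertex-intro (X + HX) (≤-trans i≤ c+1≤) j≤
      (λ eq → ⊥-elim (<⇒≱ (subst (c + 1 <_) (sym eq) c+1<) i≤))
      (λ i≡0 → ⊥-elim (<⇒≱ (subst (_< c) (sym i≡0) (s≤s z≤n)) c≤i))
      where
      c+1< : c + 1 < 2 * (X + HX) + 1
      c+1< = <-≤-trans (2*-<-mono (≤-<-trans X+a+1≤HX (m<n+m HX {X} (s≤s z≤n)))) (m≤m+n (2 * (X + HX)) 1)
      c+1≤ : c + 1 ≤ 2 * (X + HX) + 1
      c+1≤ = <⇒≤ c+1<

    crossing-valid : ∀ j → j ≤ X + HX → ValidEdge r (hor c j)
    crossing-valid j j≤ = on-path ≤-refl (m≤m+n c 1) j≤ , on-path (n≤1+n c) (≤-reflexive (+-comm 1 c)) j≤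

    valid : ∀ {d} → d ∈ darts → ValidEdge r (edgeOf d)
    valid d∈ with ∈-++⁻ column d∈
    ... | inj₂ (here refl) = crossing-valid (X + HX) ≤-refl
    ... | inj₁ q with zigzag-∈⁻ c HX X q
    ...   | inj₁ (j , _ , j< , refl) =
      on-path (m≤m+n c _) (zigzagCol≤ c j) (<⇒≤ j<) , on-path (m≤m+n c _) (zigzagCol≤ c j) j< , zigzag-ver-even (suc (X + a)) j
    ...   | inj₂ (zero , () , _ , refl)
    ...   | inj₂ (suc j , _ , j< , refl) = subst (ValidEdge r) (sym (edgeOf-rung c (suc j))) (crossing-valid (suc j) (<⇒≤ j<))

    crosses : ∀ t → t < X → ∃ (CrossesAt r s t darts end)
    crosses t t<X = hor c (hiB r t) , crossing-valid (hiB r t) (hiB≤ t) , in-layer , ∈-darts t t<X , only-crossing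
      where
      t<X+a+1 : t < suc (X + a)
      t<X+a+1 = <-trans t<X X<X+a+1
      c+1<2H : c + 1 < 2 * hiB r t
      c+1<2H = 2*-<-mono (≤-trans (s≤s X+a+1≤HX) (HX<hiB t t<X))
      in-layer : LayerE r t (hor c (hiB r t))
      in-layer = inj₁ (inj₂ refl , ≤-trans (lftC≤2t+1 r t (hiB r t)) (<⇒≤ (2*-<-mono t<X+a+1)) ,
                       ≤-trans (+1<⇒< c+1<2H) (2H≤rgtC r t (hiB r t)))
      ∈-darts : ∀ t → t < X → hor c (hiB r t) ∈ map edgeOf darts
      ∈-darts zero    _   = edgeOf-++⁺ column (bwd (hor c (X + HX)) ∷ []) (inj₂ (here refl))
      ∈-darts (suc t) t<X = edgeOf-++⁺ column (bwd (hor c (X + HX)) ∷ []) (inj₁ (rung-∈-zigzag c HX X (HX<hiB (suc t) t<X)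
                              (hiB-inner< r (s≤s z≤n) (t≤hiB (suc t) (<⇒≤ t<X)))))
      only-crossing : ∀ {v} → v ∈ walkNodes darts end → vtx (layer r s t) v → IsEndOf (hor c (hiB r t)) v
      only-crossing m on-t with nodes m
      ... | i , j , refl , HX≤j , _ , c≤i , i≤ , _
          with OnFrame-between-sides (≤-trans (2*-<-mono t<X+a+1) c≤i) (≤-trans (s≤s i≤) c+1<2H)
                 (layer-node-OnFrame r t (t≤hiB t (<⇒≤ t<X)) s on-t)
      ... | inj₁ refl = ⊥-elim (<⇒≱ (<-trans t<X X<HX) HX≤j)
      ... | inj₂ refl with between-c-c+1 c≤i i≤
      ...   | inj₁ refl = inj₁ refl
      ...   | inj₂ refl = inj₂ refl

    touches : ∃ (TouchesAt r s X darts end)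
    touches = start , start-∈-walkNodes darts walk , on-X , only-start
      where
      on-X : vtx (layer r s X) start
      on-X = hor c HX , crossing-valid HX (m≤n+m HX X) ,
             subst (λ j → LayerE r X (hor c j)) hiB-X
               (inj₁ (inj₂ refl , ≤-trans (lftC≤2t+1 r X (hiB r X)) (<⇒≤ (2*-<-mono X<X+a+1)) ,
                      subst (suc c ≤_) (sym (trans (rgtC-top r X (λ eq → <⇒≢ X<HX (sym (trans (sym hiB-X) eq))))
                                                   (cong₂ (λ h x → 2 * h + x) hiB-X X+1-odd)))
                        (subst (_≤ 2 * HX + 1) (+-comm c 1) (+-monoˡ-≤ 1 (*-monoʳ-≤ 2 X+a+1≤HX))))) ,
             src-∈-chain s (hor c HX)
      only-start : ∀ {i j} → node i j ∈ walkNodes darts end → InBox X (hiB r X) i j → node i j ≡ start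
      only-start m (_ , j≤ , _) with nodes m
      ... | i , j , eq , HX≤j , _ , _ , _ , at-start with node-injective eq
      ... | refl , refl = cong₂ node (at-start j≡HX) j≡HX
        where
        j≡HX : j ≡ HX
        j≡HX = ≤-antisym (subst (j ≤_) hiB-X j≤) HX≤j

    rail : IsRail r s X (walkPath s darts end)
    rail = walkPath-IsRail r s X darts walk (subst (1 ≤_) (sym (length-++ column)) (m≤n+m 1 (length column))) nodes-unique valid X≤hiB-X crosses touches

  record Rail : Set₁ where
    field
      start end : V
      darts : List Dart
      walk : Walk start darts end
      start-IsNode : IsNode start
      Region : ℕ → ℕ → Set
      nodes : ∀ {v} → v ∈ walkNodes darts end → NodeWith v Region
      is-rail : IsRail r s X (walkPath s darts end)

    path : List V
    path = walkPath s darts end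

  data Side : Set where
    bottom top left right : Side

  rail : Side → (a : ℕ) → a ≤ k → Rail
  rail bottom a a≤k = record { BottomRail a a≤k ; start = _ ; start-IsNode = _ , _ , refl ; is-rail = BottomRail.rail a a≤k }
  rail top    a a≤k = record { TopRail a a≤k    ; start-IsNode = _ , _ , refl ; is-rail = TopRail.rail a a≤k }
  rail left   a a≤k = record { LeftRail a a≤k   ; start = _ ; start-IsNode = _ , _ , refl ; is-rail = LeftRail.rail a a≤k }
  rail right  a a≤k = record { RightRail a a≤k  ; start-IsNode = _ , _ , refl ; is-rail = RightRail.rail a a≤k }

  column-pair-unique : ∀ {m m′ i} → 2 * m ≤ i → i ≤ 2 * m + 1 → 2 * m′ ≤ i → i ≤ 2 * m′ + 1 → m ≡ m′
  column-pair-unique {m} {m′} 2m≤ ≤2m+1 2m′≤ ≤2m′+1 with <-cmp m m′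
  ... | tri< m<m′ _ _ = ⊥-elim (<⇒≱ (2*-<-mono m<m′) (≤-trans 2m′≤ ≤2m+1))
  ... | tri≈ _ eq _   = eq
  ... | tri> _ _ m>m′ = ⊥-elim (<⇒≱ (2*-<-mono m>m′) (≤-trans 2m≤ ≤2m′+1))

  Disjoint : Side → ℕ → Side → ℕ → Set
  Disjoint σ a σ′ a′ = ∀ a≤k a′≤k {i j} → Rail.Region (rail σ a a≤k) i j → ¬ Rail.Region (rail σ′ a′ a′≤k) i j

  Disjoint-sym : ∀ {σ a σ′ a′} → Disjoint σ a σ′ a′ → Disjoint σ′ a′ σ a
  Disjoint-sym apart a′≤k a≤k p q = apart a≤k a′≤k q p

  bottom-top-apart : ∀ a a′ → Disjoint bottom a top a′
  bottom-top-apart a a′ _ _ (j≤X , _) (HX≤j , _) = <⇒≱ X<HX (≤-trans HX≤j j≤X)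

  bottom-left-apart : ∀ a a′ → Disjoint bottom a left a′
  bottom-left-apart a a′ _ _ (j≤X , _ , _ , at-X) (refl , i≤2X) =
    <⇒≱ (subst (2 * X <_) (sym (at-X (≤-antisym j≤X (m≤m+n X a′)))) (s≤s (*-monoʳ-≤ 2 (m≤m+n X a)))) i≤2X

  bottom-right-apart : ∀ a a′ → Disjoint bottom a right a′
  bottom-right-apart a a′ _ _ (j≤X , _) (refl , _) = <⇒≱ (s≤s (m≤m+n X a′)) j≤X

  top-left-apart : ∀ a a′ → Disjoint top a left a′
  top-left-apart a a′ _ a′≤k (HX≤j , _) (refl , _) = <⇒≱ (s≤s (+-monoʳ-≤ X a′≤k)) HX≤j

  top-right-apart : ∀ a a′ → Disjoint top a right a′
  top-right-apart a a′ a≤k a′≤k (HX≤j , _ , _ , _ , at-HX) (refl , 2HX+1≤ , _) =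
    <⇒≱ (≤-trans (s≤s (subst (_≤ 2 * HX) (sym (at-HX (≤-antisym (s≤s (+-monoʳ-≤ X a′≤k)) HX≤j)))
                          (*-monoʳ-≤ 2 (s≤s (+-monoʳ-≤ X a≤k)))))
                 (≤-reflexive (+-comm 1 (2 * HX)))) 2HX+1≤

  left-right-apart : ∀ a a′ → Disjoint left a right a′
  left-right-apart a a′ _ _ (_ , i≤2X) (_ , 2HX+1≤ , _) =
    <⇒≱ (≤-trans (s≤s (*-monoʳ-≤ 2 (<⇒≤ X<HX))) (≤-reflexive (+-comm 1 (2 * HX)))) (≤-trans 2HX+1≤ i≤2X)

  regions-disjoint : ∀ σ a σ′ a′ → (σ ≡ σ′ → a ≢ a′) → Disjoint σ a σ′ a′
  regions-disjoint bottom a bottom a′ distinct _ _ (_ , c≤ , ≤c , _) (_ , c′≤ , ≤c′ , _) =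
    distinct refl (+-cancelˡ-≡ X a a′ (column-pair-unique c≤ ≤c c′≤ ≤c′))
  regions-disjoint top    a top    a′ distinct _ _ (_ , _ , c≤ , ≤c , _) (_ , _ , c′≤ , ≤c′ , _) =
    distinct refl (+-cancelˡ-≡ X a a′ (suc-injective (column-pair-unique c≤ ≤c c′≤ ≤c′)))
  regions-disjoint left   a left   a′ distinct _ _ (ρ≡ , _) (ρ≡′ , _) = distinct refl (+-cancelˡ-≡ X a a′ (trans (sym ρ≡) ρ≡′))
  regions-disjoint right  a right  a′ distinct _ _ (ρ≡ , _) (ρ≡′ , _) =
    distinct refl (+-cancelˡ-≡ X a a′ (suc-injective (trans (sym ρ≡) ρ≡′)))
  regions-disjoint bottom a top    a′ _ = bottom-top-apart a a′
  regions-disjoint bottom a left   a′ _ = bottom-left-apart a a′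
  regions-disjoint bottom a right  a′ _ = bottom-right-apart a a′
  regions-disjoint top    a left   a′ _ = top-left-apart a a′
  regions-disjoint top    a right  a′ _ = top-right-apart a a′
  regions-disjoint left   a right  a′ _ = left-right-apart a a′
  regions-disjoint top    a bottom a′ _ = Disjoint-sym {bottom} {a′} {top} (bottom-top-apart a′ a)
  regions-disjoint left   a bottom a′ _ = Disjoint-sym {bottom} {a′} {left} (bottom-left-apart a′ a)
  regions-disjoint right  a bottom a′ _ = Disjoint-sym {bottom} {a′} {right} (bottom-right-apart a′ a)
  regions-disjoint left   a top    a′ _ = Disjoint-sym {top} {a′} {left} (top-left-apart a′ a)
  regions-disjoint right  a top    a′ _ = Disjoint-sym {top} {a′} {right} (top-right-apart a′ a)
  regions-disjoint right  a left   a′ _ = Disjoint-sym {left} {a′} {right} (left-right-apart a′ a)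

  rails-disjoint : ∀ σ a σ′ a′ a≤k a′≤k → (σ ≡ σ′ → a ≢ a′) →
    ∀ v → v ∈ Rail.path (rail σ a a≤k) → v ∉ Rail.path (rail σ′ a′ a′≤k)
  rails-disjoint σ a σ′ a′ a≤k a′≤k distinct =
    walkPaths-disjoint s (R.darts) (R′.darts) R.walk R.start-IsNode R′.walk R′.start-IsNode disjoint-nodes
    where
    module R = Rail (rail σ a a≤k)
    module R′ = Rail (rail σ′ a′ a′≤k)
    disjoint-nodes : ∀ {v} → v ∈ walkNodes R.darts R.end → v ∉ walkNodes R′.darts R′.end
    disjoint-nodes m m′ with R.nodes m | R′.nodes m′
    ... | i , j , eq , in-R | i′ , j′ , eq′ , in-R′ with node-injective (trans (sym eq) eq′)
    ... | refl , refl = regions-disjoint σ a σ′ a′ distinct a≤k a′≤k in-R in-R′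

  side : Fin 4 → Side
  side 0F = bottom
  side 1F = top
  side 2F = left
  side 3F = right

  side-injective : ∀ {q q′} → side q ≡ side q′ → q ≡ q′
  side-injective {q} {q′} eq = trans (sym (index-side q)) (trans (cong index eq) (index-side q′))
    where
    index : Side → Fin 4
    index bottom = 0F
    index top    = 1F
    index left   = 2F
    index right  = 3F
    index-side : ∀ q → index (side q) ≡ q
    index-side 0F = refl
    index-side 1F = refl
    index-side 2F = refl
    index-side 3F = refl

  railIndex : ∀ {y} → y ≤ 4 * suc k → Fin y → Fin 4 × Fin (suc k)
  railIndex y≤ j = remQuot (suc k) (inject≤ j y≤)

  railIndex-injective : ∀ {y} (y≤ : y ≤ 4 * suc k) {j j′} → railIndex y≤ j ≡ railIndex y≤ j′ → j ≡ j′
  railIndex-injective y≤ {j} {j′} eq = inject≤-injective y≤ y≤ j j′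
    (trans (sym (combine-remQuot {4} (suc k) (inject≤ j y≤))) (trans (cong (uncurry combine) eq) (combine-remQuot (suc k) (inject≤ j′ y≤))))

  railOf : ∀ {y} → y ≤ 4 * suc k → Fin y → Rail
  railOf y≤ j = rail (side (proj₁ (railIndex y≤ j))) (toℕ (proj₂ (railIndex y≤ j))) (toℕ≤pred[n] (proj₂ (railIndex y≤ j)))

  rails : ∀ {y} → y ≤ 4 * suc k → Fin y → List V
  rails y≤ j = Rail.path (railOf y≤ j)

  rails-pairwise-disjoint : ∀ {y} (y≤ : y ≤ 4 * suc k) j j′ → j ≢ j′ → ∀ v → v ∈ rails y≤ j → v ∉ rails y≤ j′
  rails-pairwise-disjoint y≤ j j′ j≢j′ = rails-disjoint _ _ _ _ _ _
    (λ same-side same-a → j≢j′ (railIndex-injective y≤ (cong₂ _,_ (side-injective same-side) (toℕ-injective same-a))))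

  layers-are-cycles : ∀ t → t < suc X → IsCycleGraph (layer r s t)
  layers-are-cycles t (s≤s t≤X) = layer-IsCycleGraph r s t ((X ∸ t) + κ)
    (trans (cong (λ X′ → suc (X′ + suc (X′ + k))) (sym (m∸n+n≡m t≤X))) (layer-height (X ∸ t) t κ))

  layers-pairwise-disjoint : ∀ t t′ → t < suc X → t′ < suc X → t ≢ t′ → ∀ v → vtx (layer r s t) v → vtx (layer r s t′) v → ⊥
  layers-pairwise-disjoint t t′ (s≤s t≤X) (s≤s t′≤X) t≢t′ v on-t on-t′ with <-cmp t t′
  ... | tri< t<t′ _ _ = layers-disjoint r t<t′ (t≤hiB t′ t′≤X) s v on-t on-t′
  ... | tri≈ _ t≡t′ _ = t≢t′ t≡t′
  ... | tri> _ _ t>t′ = layers-disjoint r t>t′ (t≤hiB t t≤X) s v on-t′ on-t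

  layers-nested : ∀ t → suc t < suc X → ∀ v → OpenDisk r s (suc t) v → OpenDisk r s t v
  layers-nested t (s≤s t+1≤X) v in-disk = inner-compass⊆OpenDisk r (n<1+n t) (t≤hiB (suc t) t+1≤X) s v (proj₁ in-disk)

  railed-annulus : ∀ {y} → y ≤ 4 * suc k → Σ (Fin y → List V) (RailedAnnulusOfLayers r s (suc X) y)
  railed-annulus y≤ = rails y≤ ,
    layers-are-cycles , layers-pairwise-disjoint , layers-nested ,
    (λ j → proj₁ (Rail.is-rail (railOf y≤ j))) , rails-pairwise-disjoint y≤ ,
    (λ j → proj₂ (proj₂ (Rail.is-rail (railOf y≤ j)))) ,
    (λ t j t<x → proj₁ (proj₂ (Rail.is-rail (railOf y≤ j))) t t<x)

-- The wall height

odd-half : ∀ n → n % 2 ≡ 1 → ∃ λ c → n ≡ suc (c + c)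
odd-half zero          ()
odd-half (suc zero)    _  = 0 , refl
odd-half (suc (suc n)) n-odd with odd-half n n-odd
... | c , refl = suc c , cong (suc ∘ suc) (sym (+-suc c c))

odd-%2 : ∀ p → odd p % 2 ≡ 1
odd-%2 p with parity-suc p
... | inj₁ (p%2≡0 , p+1%2≡1) rewrite p%2≡0 = trans (cong (_% 2) (+-comm p 1)) p+1%2≡1
... | inj₂ (p%2≡1 , _)       rewrite p%2≡1 = trans (cong (_% 2) (+-identityʳ p)) p%2≡1

y≤⌈y/4⌉*4 : ∀ y → y ≤ ((y + 3) / 4) * 4
y≤⌈y/4⌉*4 y = +-cancelˡ-≤ 3 y _ (begin
  3 + y                          ≡⟨ +-comm 3 y ⟩
  y + 3                          ≡⟨ m≡m%n+[m/n]*n (y + 3) 4 ⟩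
  (y + 3) % 4 + (y + 3) / 4 * 4  ≤⟨ +-monoˡ-≤ _ (≤-pred (m%n<n (y + 3) 4)) ⟩
  3 + (y + 3) / 4 * 4            ∎)
  where open ≤-Reasoning

⌈y/4⌉∸1≤k⇒y≤4[k+1] : ∀ y k → (y + 3) / 4 ∸ 1 ≤ k → y ≤ 4 * suc k
⌈y/4⌉∸1≤k⇒y≤4[k+1] y k ≤k = begin
  y                      ≤⟨ y≤⌈y/4⌉*4 y ⟩
  (y + 3) / 4 * 4        ≤⟨ *-monoˡ-≤ 4 (∸1≤⇒≤suc ((y + 3) / 4) ≤k) ⟩
  suc k * 4              ≡⟨ *-comm (suc k) 4 ⟩
  4 * suc k              ∎
  where
  open ≤-Reasoning
  ∸1≤⇒≤suc : ∀ q → q ∸ 1 ≤ k → q ≤ suc k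
  ∸1≤⇒≤suc zero    _   = z≤n
  ∸1≤⇒≤suc (suc q) q≤k = s≤s q≤k

height-identity : ∀ X c → 2 * suc X + suc (c + c) ≡ suc (X + suc (X + suc (c + c)))
height-identity = solve-∀

central-identity : ∀ X ζ w → suc (X + suc (X + suc ((ζ + w) + (ζ + w)))) ≡ (suc X + w) * 2 + suc (ζ + ζ)
central-identity = solve-∀

central-identity′ : ∀ X ζ w → suc (X + suc (X + suc ((ζ + w) + (ζ + w)))) ≡ suc ((suc X + w) + ((suc X + w) + (ζ + ζ)))
central-identity′ = solve-∀

wallHeight-shape : ∀ x y z → 3 ≤ x → x % 2 ≡ 1 → ∃₂ λ u κ → let open Dimensions u κ in
  x ≡ suc X × wallHeight x y z ≡ r × y ≤ 4 * suc k × z ≤ k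
wallHeight-shape x y z 3≤x x-odd with odd-half x x-odd
... | zero  , refl = ⊥-elim (<⇒≱ 3≤x (s≤s z≤n))
... | suc u , refl = u , κ , cong (suc ∘ suc) (+-suc u u) , h≡r , y≤ , z≤k
  where
  x′ M h k₀ : ℕ
  x′ = suc (suc u + suc u)
  M  = z ⊔ ((y + 3) / 4 ∸ 1)
  h  = wallHeight x′ y z
  k₀ = h ∸ 2 * x′
  h≡ : h ≡ 2 * x′ + k₀
  h≡ = sym (m+[n∸m]≡n (≤-trans (m≤m+n (2 * x′) M) (m≤m+n _ _)))
  k₀-odd : k₀ % 2 ≡ 1
  k₀-odd = begin
    k₀ % 2                 ≡⟨ [d+d+x]%2≡x%2 x′ k₀ ⟨
    (x′ + x′ + k₀) % 2     ≡⟨ cong (λ n → (n + k₀) % 2) (2*-double x′) ⟨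
    (2 * x′ + k₀) % 2      ≡⟨ cong (_% 2) h≡ ⟨
    h % 2                  ≡⟨ odd-%2 (2 * x′ + M) ⟩
    1                      ∎
    where open ≡-Reasoning
  κ : ℕ
  κ = proj₁ (odd-half k₀ k₀-odd)
  k₀≡ : k₀ ≡ suc (κ + κ)
  k₀≡ = proj₂ (odd-half k₀ k₀-odd)
  open Dimensions u κ
  h≡r : h ≡ r
  h≡r = trans h≡ (trans (cong (λ n → 2 * x′ + n) k₀≡)
                 (trans (cong (λ n → 2 * suc (suc n) + suc (κ + κ)) (+-suc u u)) (height-identity X κ)))
  M≤k : M ≤ k
  M≤k = subst (M ≤_) k₀≡ (+-cancelˡ-≤ (2 * x′) M k₀ (subst (2 * x′ + M ≤_) h≡ (m≤m+n _ _)))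
  z≤k : z ≤ k
  z≤k = ≤-trans (m≤m⊔n z _) M≤k
  y≤ : y ≤ 4 * suc k
  y≤ = ⌈y/4⌉∸1≤k⇒y≤4[k+1] y k (≤-trans (m≤n⊔m z _) M≤k)

central-subwall-inside : ∀ u κ z → z % 2 ≡ 1 → let open Dimensions u κ in
  z ≤ k → X < (r ∸ z) / 2 × (r ∸ z) / 2 ≤ hiB r ((r ∸ z) / 2)
central-subwall-inside u κ z z-odd z≤k with odd-half z z-odd
... | ζ , refl = subst (λ T → X < T × T ≤ hiB r T) (sym T≡) (s≤s (m≤m+n X w) , T≤hiB)
  where
  open Dimensions u κ
  ζ≤κ : ζ ≤ κ
  ζ≤κ = ≮⇒≥ (λ κ<ζ → <⇒≱ (s≤s (+-mono-< κ<ζ κ<ζ)) z≤k)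
  w T : ℕ
  w = κ ∸ ζ
  T = suc X + w
  r≡ : r ≡ suc (X + suc (X + suc ((ζ + w) + (ζ + w))))
  r≡ = cong (λ c → suc (X + suc (X + suc (c + c)))) (sym (m+[n∸m]≡n ζ≤κ))
  T≡ : (r ∸ suc (ζ + ζ)) / 2 ≡ T
  T≡ = begin
    (r ∸ suc (ζ + ζ)) / 2                    ≡⟨ cong (λ n → (n ∸ suc (ζ + ζ)) / 2) (trans r≡ (central-identity X ζ w)) ⟩
    (T * 2 + suc (ζ + ζ) ∸ suc (ζ + ζ)) / 2  ≡⟨ cong (_/ 2) (m+n∸n≡m (T * 2) (suc (ζ + ζ))) ⟩
    T * 2 / 2                                ≡⟨ m*n/n≡m T 2 ⟩
    T                                        ∎
    where open ≡-Reasoning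
  T≤hiB : T ≤ hiB r T
  T≤hiB = subst (T ≤_) (sym (trans (cong (λ n → n ∸ 1 ∸ T) (trans r≡ (central-identity′ X ζ w))) (m+n∸m≡n T (T + (ζ + ζ)))))
            (m≤m+n T (ζ + ζ))

proposition12 : (x y z : ℕ) → 3 ≤ x → x % 2 ≡ 1 → 3 ≤ z → z % 2 ≡ 1 → 1 ≤ y →
    (s : EEdge → ℕ) →
    Σ (Fin y → List V) (λ P → RailedAnnulusOfLayers (wallHeight x y z) s x y P)
    × (∀ v → vtx (centralCompass (wallHeight x y z) s z) v → OpenDisk (wallHeight x y z) s (x ∸ 1) v)
proposition12 x y z 3≤x x-odd _ z-odd _ s with wallHeight-shape x y z 3≤x x-odd
... | u , κ , refl , h≡r , y≤ , z≤k rewrite h≡r with central-subwall-inside u κ z z-odd z≤k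
...   | X<T , T≤hiB = Wall.railed-annulus s u κ y≤ , inner-compass⊆OpenDisk (Dimensions.r u κ) X<T T≤hiB s
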